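{- Let $s\geq 4$. No antipodal plane of order $s$ can be embedded in a Desarguesian projective plane $\mathrm{PG}(2,q)$, for any prime power $q$.
   Context: An antipodal plane of order $s\geq 2$ is a partial linear space $(\mathcal{P},\mathcal{L})$ (each line a subset of $\mathcal{P}$ of size at least $2$, two distinct points on at most one line) with $|\mathcal{P}|=|\mathcal{L}|=s^2+s+2$, every line containing $s+1$ points and every point on $s+1$ lines. An incidence structure $(\mathcal{P},\mathcal{L})$ is embedded in a projective plane $\Pi$ if there are injective maps $\phi$ from $\mathcal{P}$ to the points of $\Pi$ and $\psi$ from $\mathcal{L}$ to the lines of $\Pi$ which preserve incidence and non-incidence. -}

module Defs where

open import Level using (Level; _⊔_) renaming (suc to lsuc)
open import Data.Nat using (ℕ)
import Data.Nat as N
open import Data.Fin using (Fin; zero; suc)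
open import Data.Fin.Subset using (Subset; _∈_; ∣_∣)
open import Data.Vec using (tabulate; lookup)
open import Data.Product using (Σ; ∃; _×_; _,_)
open import Relation.Binary.PropositionalEquality using (_≡_; _≢_)
open import Relation.Nullary using (¬_)
open import Function.Definitions using (Injective)
open import Algebra.Bundles using (CommutativeRing)

np : ℕ → ℕ
np s = s N.* s N.+ s N.+ 2

record AntipodalPlane (s : ℕ) : Set where
  field
    line        : Fin (np s) → Subset (np s)
    lines-distinct : Injective _≡_ _≡_ line
    partialLinear : ∀ (p q : Fin (np s)) → p ≢ q →
                    ∀ (l m : Fin (np s)) →
                    p ∈ line l → q ∈ line l → p ∈ line m → q ∈ line m →
                    l ≡ m
    lineSize    : ∀ l → ∣ line l ∣ ≡ s N.+ 1
    -- every point lies on s+1 lines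
    pointDegree : ∀ p → ∣ tabulate (λ l → lookup (line l) p) ∣ ≡ s N.+ 1

-- Finite fields (the fields GF(q), q a prime power, are exactly the
-- finite fields).

record FiniteField (c ℓ : Level) : Set (lsuc (c ⊔ ℓ)) where
  field
    commRing : CommutativeRing c ℓ
  open CommutativeRing commRing public
  field
    1≉0     : ¬ (1# ≈ 0#)
    inverse : ∀ x → ¬ (x ≈ 0#) → ∃ λ y → x * y ≈ 1#
    size    : ℕ
    enum    : Fin size → Carrier
    enum-surjective : ∀ x → ∃ λ i → enum i ≈ x

-- The Desarguesian plane PG(2,F) in homogeneous coordinates:
-- points are nonzero vectors of F³ up to nonzero scalars, lines are
-- nonzero vectors of (F³)* up to nonzero scalars (a line = kernel of a
-- nonzero linear functional), and point x lies on line a iff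
-- a₀x₀ + a₁x₁ + a₂x₂ = 0.

module PG2 {c ℓ} (F : FiniteField c ℓ) where
  open FiniteField F using (Carrier; _≈_; _+_; _*_; 0#)

  Vec3 : Set c
  Vec3 = Fin 3 → Carrier

  Nonzero : Vec3 → Set ℓ
  Nonzero v = ¬ (∀ i → v i ≈ 0#)

  Proportional : Vec3 → Vec3 → Set (c ⊔ ℓ)
  Proportional u v = ∃ λ (k : Carrier) → ∀ i → u i ≈ k * v i

  dot : Vec3 → Vec3 → Carrier
  dot a x = a zero * x zero + a (suc zero) * x (suc zero)
          + a (suc (suc zero)) * x (suc (suc zero))

  Incident : Vec3 → Vec3 → Set ℓ
  Incident x a = dot a x ≈ 0#

  record Embedding {s : ℕ} (A : AntipodalPlane s) : Set (c ⊔ ℓ) where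
    open AntipodalPlane A
    field
      φ : Fin (np s) → Vec3
      ψ : Fin (np s) → Vec3
      φ-nonzero : ∀ p → Nonzero (φ p)
      ψ-nonzero : ∀ l → Nonzero (ψ l)
      φ-injective : ∀ p q → Proportional (φ p) (φ q) → p ≡ q
      ψ-injective : ∀ l m → Proportional (ψ l) (ψ m) → l ≡ m
      incidence    : ∀ p l → p ∈ line l → Incident (φ p) (ψ l)
      nonincidence : ∀ p l → ¬ (p ∈ line l) → ¬ Incident (φ p) (ψ l)

module Submission where

-- Fix a line L of the antipodal plane and the unique line L′ disjoint from it.  Every point x
-- of L is collinear with all points of L′ but one, its antipode σ x, and every point q off
-- L ∪ L′ induces a perspectivity τ_q : L → L′ that avoids σ; the s − 1 further points of the
-- line through x and y ≠ σ x give s − 1 distinct perspectivities sending x to y.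
-- In PG(2,F), affine coordinates on L and L′ that put the common point of their images at
-- infinity turn every τ_q into an affine map.  Affine maps are bijections determined by two
-- values and closed under f ∘ g⁻¹ ∘ h, and for s ≥ 4 counting inside such a family shows that
-- s − 1 maps through every pair (x, y) with y ≠ σ x, all avoiding σ, cannot exist.

open import Defs
open import Data.Nat using (ℕ; _≤_; zero; suc; z≤n; s≤s)
import Data.Nat as Nat
open import Data.Fin using (Fin; zero; suc)
open import Data.Product using (Σ; _,_)
open import Function.Definitions using (Injective)
open import Relation.Nullary using (¬_)
open import Relation.Binary.PropositionalEquality using (_≡_)
open import Algebra.Bundles using (CommutativeRing)
open import Algebra.Bundles.Raw using (RawRing)

module FiniteSets where

  open import Data.Nat as ℕ using (ℕ; zero; suc; _≤_; _<_)
  import Data.Nat.Properties as ℕ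
  open import Data.Fin as Fin using (Fin; zero; suc; combine; remQuot)
  import Data.Fin.Properties as Fin
  open import Data.Fin.Subset using (Subset; _∈_; _∉_; ∣_∣; inside; outside; ⁅_⁆; _─_; _-_)
  open import Data.Fin.Subset.Properties using (_∈?_; p─q⊆p; p─⊥≡p; x∈⁅x⁆)
  open import Data.Vec using (_∷_; tabulate; here; there)
  open import Data.Vec.Properties using (lookup⇒[]=; []=⇒lookup; lookup∘tabulate)
  open import Data.Product using (∃; _×_; _,_; proj₁; proj₂; uncurry)
  open import Function.Definitions using (Injective)
  open import Relation.Nullary using (Dec; yes; no; ¬?; does)
  open import Relation.Nullary.Negation using (contradiction)
  open import Relation.Binary.PropositionalEquality

  enum : ∀ {N} (p : Subset N) → Fin ∣ p ∣ → Fin N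
  enum (inside ∷ p) zero    = zero
  enum (inside ∷ p) (suc i) = suc (enum p i)
  enum (outside ∷ p) i      = suc (enum p i)

  enum-∈ : ∀ {N} (p : Subset N) i → enum p i ∈ p
  enum-∈ (inside ∷ p) zero    = here
  enum-∈ (inside ∷ p) (suc i) = there (enum-∈ p i)
  enum-∈ (outside ∷ p) i      = there (enum-∈ p i)

  enum-injective : ∀ {N} (p : Subset N) → Injective _≡_ _≡_ (enum p)
  enum-injective (inside ∷ p)  {zero}  {zero}  _ = refl
  enum-injective (inside ∷ p)  {suc i} {suc j} e = cong suc (enum-injective p (Fin.suc-injective e))
  enum-injective (outside ∷ p) e = enum-injective p (Fin.suc-injective e)

  enum-surjective : ∀ {N} (p : Subset N) {x} → x ∈ p → ∃ λ i → enum p i ≡ x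
  enum-surjective (inside ∷ p)  here        = zero , refl
  enum-surjective (inside ∷ p)  (there x∈p) = let i , e = enum-surjective p x∈p in suc i , cong suc e
  enum-surjective (outside ∷ p) (there x∈p) = let i , e = enum-surjective p x∈p in i , cong suc e

  record Enumeration {N : ℕ} (k : ℕ) (p : Subset N) : Set where
    field
      at            : Fin k → Fin N
      at-∈          : ∀ i → at i ∈ p
      at-injective  : Injective _≡_ _≡_ at
      at-surjective : ∀ {x} → x ∈ p → ∃ λ i → at i ≡ x

  opaque
    enumeration : ∀ {N k} (p : Subset N) → ∣ p ∣ ≡ k → Enumeration k p
    enumeration p refl = record
      { at = enum p ; at-∈ = enum-∈ p ; at-injective = enum-injective p ; at-surjective = enum-surjective p }

  injective-into⇒≤ : ∀ {k N} (p : Subset N) (f : Fin k → Fin N) →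
                     (∀ i → f i ∈ p) → Injective _≡_ _≡_ f → k ≤ ∣ p ∣
  injective-into⇒≤ p f f∈p f-inj = Fin.injective⇒≤ {f = index} λ {i} {j} e → f-inj (begin
    f i                  ≡⟨ proj₂ (enum-surjective p (f∈p i)) ⟨
    enum p (index i)     ≡⟨ cong (enum p) e ⟩
    enum p (index j)     ≡⟨ proj₂ (enum-surjective p (f∈p j)) ⟩
    f j                  ∎)
    where
    open ≡-Reasoning
    index : _ → Fin ∣ p ∣
    index i = proj₁ (enum-surjective p (f∈p i))

  covering⇒≥ : ∀ {k N} (p : Subset N) (f : Fin k → Fin N) →
               (∀ {x} → x ∈ p → ∃ λ i → f i ≡ x) → ∣ p ∣ ≤ k
  covering⇒≥ p f cover = Fin.injective⇒≤ {f = preimage} λ {a} {b} e → enum-injective p (begin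
    enum p a             ≡⟨ proj₂ (cover (enum-∈ p a)) ⟨
    f (preimage a)       ≡⟨ cong f e ⟩
    f (preimage b)       ≡⟨ proj₂ (cover (enum-∈ p b)) ⟩
    enum p b             ∎)
    where
    open ≡-Reasoning
    preimage : Fin ∣ p ∣ → _
    preimage a = proj₁ (cover (enum-∈ p a))

  opaque
    ∣p∣<n⇒∃∉ : ∀ {N} (p : Subset N) → ∣ p ∣ < N → ∃ λ x → x ∉ p
    ∣p∣<n⇒∃∉ {N} p ∣p∣<N with Fin.any? (λ x → ¬? (x ∈? p))
    ... | yes x∉p = x∉p
    ... | no ∄x∉p = contradiction (injective-into⇒≤ p (λ x → x) all∈ (λ e → e)) (ℕ.<⇒≱ ∣p∣<N)
      where
      all∈ : ∀ x → x ∈ p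
      all∈ x with x ∈? p
      ... | yes x∈p = x∈p
      ... | no  x∉p = contradiction (x , x∉p) ∄x∉p

  opaque
    ∃-missed : ∀ {k n} (f : Fin k → Fin n) → k < n → ∃ λ w → ∀ i → f i ≢ w
    ∃-missed {k} {n} f k<n with Fin.any? (λ w → Fin.all? (λ i → ¬? (f i Fin.≟ w)))
    ... | yes missed = missed
    ... | no ∄missed = contradiction (Fin.injective⇒≤ {f = preimage} preimage-injective) (ℕ.<⇒≱ k<n)
      where
      hit : ∀ w → ∃ λ i → f i ≡ w
      hit w with Fin.any? (λ i → f i Fin.≟ w)
      ... | yes h = h
      ... | no ¬h = contradiction (w , λ i e → ¬h (i , e)) ∄missed
      preimage : Fin n → Fin k
      preimage w = proj₁ (hit w)
      preimage-injective : Injective _≡_ _≡_ preimage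
      preimage-injective {a} {b} e = trans (sym (proj₂ (hit a))) (trans (cong f e) (proj₂ (hit b)))

  opaque
    injective⇒surjective : ∀ {n} (f : Fin n → Fin n) → Injective _≡_ _≡_ f → ∀ y → ∃ λ x → f x ≡ y
    injective⇒surjective {n} f f-inj y with Fin.any? (λ x → f x Fin.≟ y)
    ... | yes hit = hit
    ... | no miss = contradiction (Fin.injective⇒≤ {f = g} g-inj) (ℕ.<-irrefl refl)
      where
      g : Fin (suc n) → Fin n
      g zero    = y
      g (suc x) = f x
      g-inj : Injective _≡_ _≡_ g
      g-inj {zero}  {zero}  _ = refl
      g-inj {zero}  {suc j} e = contradiction (j , sym e) miss
      g-inj {suc i} {zero}  e = contradiction (i , e) miss
      g-inj {suc i} {suc j} e = cong suc (f-inj e)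

  x∈p─q⇒x∉q : ∀ {N} (p q : Subset N) {x} → x ∈ p ─ q → x ∉ q
  x∈p─q⇒x∉q (inside ∷ p) (outside ∷ q) here ()
  x∈p─q⇒x∉q (_ ∷ p)      (_ ∷ q)       (there x∈p─q) (there x∈q) = x∈p─q⇒x∉q p q x∈p─q x∈q

  x∈p-y⇒x≢y : ∀ {N} (p : Subset N) {x y} → x ∈ p - y → x ≢ y
  x∈p-y⇒x≢y p {y = y} x∈p-y refl = x∈p─q⇒x∉q p ⁅ y ⁆ x∈p-y (x∈⁅x⁆ y)

  x∈p-y⇒x∈p : ∀ {N} (p : Subset N) {x y} → x ∈ p - y → x ∈ p
  x∈p-y⇒x∈p p {y = y} = p─q⊆p p ⁅ y ⁆

  suc∣p-x∣≡∣p∣ : ∀ {N} (p : Subset N) {x} → x ∈ p → suc ∣ p - x ∣ ≡ ∣ p ∣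
  suc∣p-x∣≡∣p∣ (inside ∷ p)  here        = cong (λ q → suc ∣ q ∣) (p─⊥≡p p)
  suc∣p-x∣≡∣p∣ (inside ∷ p)  (there x∈p) = cong suc (suc∣p-x∣≡∣p∣ p x∈p)
  suc∣p-x∣≡∣p∣ (outside ∷ p) (there x∈p) = suc∣p-x∣≡∣p∣ p x∈p

  module _ {N : ℕ} {P : Fin N → Set} (P? : ∀ x → Dec (P x)) where

    satisfying : Subset N
    satisfying = tabulate (λ x → does (P? x))

    P⇒∈satisfying : ∀ {x} → P x → x ∈ satisfying
    P⇒∈satisfying {x} px = lookup⇒[]= x satisfying (trans (lookup∘tabulate _ x) (does-yes (P? x)))
      where
      does-yes : (d : Dec (P x)) → does d ≡ inside
      does-yes (yes _) = refl
      does-yes (no ¬px) = contradiction px ¬px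

    ∈satisfying⇒P : ∀ {x} → x ∈ satisfying → P x
    ∈satisfying⇒P {x} x∈ = witness (P? x) (trans (sym (lookup∘tabulate _ x)) ([]=⇒lookup x∈))
      where
      witness : (d : Dec (P x)) → does d ≡ inside → P x
      witness (yes px) _ = px

  uncurryFin : ∀ {a b X} → (Fin a → Fin b → Fin X) → Fin (a ℕ.* b) → Fin X
  uncurryFin {b = b} g k = uncurry g (remQuot b k)

  uncurryFin-injective : ∀ {a b X} (g : Fin a → Fin b → Fin X) →
    (∀ {i j i′ j′} → g i j ≡ g i′ j′ → i ≡ i′ × j ≡ j′) → Injective _≡_ _≡_ (uncurryFin {a} {b} g)
  uncurryFin-injective {a} {b} g g-inj {k} {k′} e with g-inj e
  ... | i≡i′ , j≡j′ = begin
    k                                    ≡⟨ Fin.combine-remQuot {a} b k ⟨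
    uncurry combine (remQuot {a} b k)    ≡⟨ cong₂ combine i≡i′ j≡j′ ⟩
    uncurry combine (remQuot {a} b k′)   ≡⟨ Fin.combine-remQuot {a} b k′ ⟩
    k′                                   ∎
    where open ≡-Reasoning

  uncurryFin-combine : ∀ {a b X} (g : Fin a → Fin b → Fin X) i j →
                       uncurryFin {a} {b} g (combine i j) ≡ g i j
  uncurryFin-combine {a} {b} g i j = cong (uncurry g) (Fin.remQuot-combine {a} {b} i j)

module AvoidingCover {t} (q : ℕ) (𝒯 : (Fin (5 Nat.+ q) → Fin (5 Nat.+ q)) → Set t) where

  open import Data.Nat as ℕ using (_+_; s≤s; z≤n)
  import Data.Nat.Properties as ℕ
  open import Data.Fin.Properties using (_≟_; any?; all?; injective⇒≤)
  open import Data.Product using (∃; _×_; _,_; proj₁; proj₂)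
  open import Data.Empty using (⊥)
  open import Relation.Nullary using (yes; no)
  open import Relation.Nullary.Negation using (contradiction)
  open import Relation.Binary.PropositionalEquality

  open FiniteSets using (injective⇒surjective; ∃-missed)

  n : ℕ
  n = 5 + q

  Map : Set
  Map = Fin n → Fin n

  record Family (k : ℕ) (x y : Fin n) : Set t where
    field
      map          : Fin k → Map
      map-∈        : ∀ a → 𝒯 (map a)
      map-x        : ∀ a → map a x ≡ y
      map-distinct : ∀ {a b} → a ≢ b → ¬ (∀ z → map a z ≡ map b z)

  Avoids : Map → Map → Set
  Avoids σ f = ∀ z → f z ≢ σ z

  module _
    (σ : Map) (σ-injective : Injective _≡_ _≡_ σ)
    (𝒯-injective : ∀ {f} → 𝒯 f → Injective _≡_ _≡_ f)
    (𝒯-rigid : ∀ {f g} → 𝒯 f → 𝒯 g → ∀ {i j} → i ≢ j → f i ≡ g i → f j ≡ g j → ∀ z → f z ≡ g z)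
    -- the map F is f ∘ g⁻¹ ∘ h
    (𝒯-closed : ∀ {f g h} → 𝒯 f → 𝒯 g → 𝒯 h → ∃ λ F → 𝒯 F × (∀ x k → h x ≡ g k → F x ≡ f k))
    (cover : ∀ x y → y ≢ σ x → Σ (Family (3 + q) x y) λ Φ → ∀ a → Avoids σ (Family.map Φ a))
    where

    ∃≢₂ : (u v : Fin n) → ∃ λ w → w ≢ u × w ≢ v
    ∃≢₂ u v with ∃-missed {2} (λ { zero → u ; (suc zero) → v }) (s≤s (s≤s (s≤s z≤n)))
    ... | w , missed = w , (λ e → missed zero (sym e)) , (λ e → missed (suc zero) (sym e))

    ∃≢ : (x : Fin n) → ∃ λ z → z ≢ x
    ∃≢ x = let z , z≢x , _ = ∃≢₂ x x in z , z≢x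

    𝒯-surjective : ∀ {f} → 𝒯 f → ∀ y → ∃ λ x → f x ≡ y
    𝒯-surjective {f} f∈𝒯 = injective⇒surjective f (𝒯-injective f∈𝒯)

    distinct-at : ∀ {k x y} (Φ : Family k x y) {z} → z ≢ x →
                  ∀ {a b} → a ≢ b → Family.map Φ a z ≢ Family.map Φ b z
    distinct-at Φ z≢x a≢b e = map-distinct a≢b (𝒯-rigid (map-∈ _) (map-∈ _) z≢x e (trans (map-x _) (sym (map-x _))))
      where open Family Φ

    family-too-large : ∀ {x y} → ¬ Family n x y
    family-too-large {x} {y} Φ = contradiction (injective⇒≤ {f = g} g-injective) (ℕ.<-irrefl refl)
      where
      open Family Φ
      z = proj₁ (∃≢ x)
      z≢x = proj₂ (∃≢ x)
      misses-y : ∀ a → map a z ≢ y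
      misses-y a e = z≢x (𝒯-injective (map-∈ a) (trans e (sym (map-x a))))
      g : Fin (suc n) → Fin n
      g zero    = y
      g (suc a) = map a z
      g-injective : Injective _≡_ _≡_ g
      g-injective {zero}  {zero}  _ = refl
      g-injective {zero}  {suc b} e = contradiction (sym e) (misses-y b)
      g-injective {suc a} {zero}  e = contradiction e (misses-y a)
      g-injective {suc a} {suc b} e with a ≟ b
      ... | yes a≡b = cong suc a≡b
      ... | no  a≢b = contradiction e (distinct-at Φ z≢x a≢b)

    some-map : ∀ x y → y ≢ σ x → ∃ λ f → 𝒯 f × f x ≡ y
    some-map x y y≢σx = let Φ , _ = cover x y y≢σx in
      Family.map Φ zero , Family.map-∈ Φ zero , Family.map-x Φ zero

    -- φ ↦ φ ∘ g⁻¹ ∘ h for maps with h x′ = g x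
    retarget-source : ∀ {k x y} → Family k x y → ∀ x′ → Family k x′ y
    retarget-source {k} {x} {y} Φ x′ = record
      { map = λ a → proj₁ (F a) ; map-∈ = λ a → proj₁ (proj₂ (F a))
      ; map-x = λ a → trans (proj₂ (proj₂ (F a)) x′ x (trans hx′ (sym gx))) (map-x a)
      ; map-distinct = λ a≢b F≗F → map-distinct a≢b λ z →
          let w , hw = 𝒯-surjective h∈𝒯 (g z) in
          trans (sym (proj₂ (proj₂ (F _)) w z hw)) (trans (F≗F w) (proj₂ (proj₂ (F _)) w z hw)) }
      where
      open Family Φ
      u = ∃≢₂ (σ x′) (σ x)
      h∈ = some-map x′ (proj₁ u) (proj₁ (proj₂ u))
      g∈ = some-map x (proj₁ u) (proj₂ (proj₂ u))
      h = proj₁ h∈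
      g = proj₁ g∈
      h∈𝒯 = proj₁ (proj₂ h∈)
      hx′ = proj₂ (proj₂ h∈)
      gx = proj₂ (proj₂ g∈)
      F : ∀ a → ∃ λ F → 𝒯 F × (∀ x k → h x ≡ g k → F x ≡ map a k)
      F a = 𝒯-closed (map-∈ a) (proj₁ (proj₂ g∈)) h∈𝒯

    σ⁻¹ : Fin n → Fin n
    σ⁻¹ y = proj₁ (injective⇒surjective σ σ-injective y)

    σ∘σ⁻¹ : ∀ y → σ (σ⁻¹ y) ≡ y
    σ∘σ⁻¹ y = proj₂ (injective⇒surjective σ σ-injective y)

    -- φ ↦ f ∘ g⁻¹ ∘ φ for maps with g z = y and f z = y′
    retarget-target : ∀ {k x y} → Family k x y → ∀ y′ → Family k x y′
    retarget-target {k} {x} {y} Φ y′ = record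
      { map = λ a → proj₁ (F a) ; map-∈ = λ a → proj₁ (proj₂ (F a))
      ; map-x = λ a → trans (proj₂ (proj₂ (F a)) x z (trans (map-x a) (sym gz))) fz
      ; map-distinct = λ {a} {b} a≢b F≗F → map-distinct a≢b λ w →
          let k₁ , gk₁ = 𝒯-surjective g∈𝒯 (map a w)
              k₂ , gk₂ = 𝒯-surjective g∈𝒯 (map b w)
              fk₁≡fk₂ = trans (sym (proj₂ (proj₂ (F a)) w k₁ (sym gk₁)))
                              (trans (F≗F w) (proj₂ (proj₂ (F b)) w k₂ (sym gk₂)))
          in trans (sym gk₁) (trans (cong g (𝒯-injective f∈𝒯 fk₁≡fk₂)) gk₂) }
      where
      open Family Φ
      u = ∃≢₂ (σ⁻¹ y) (σ⁻¹ y′)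
      z = proj₁ u
      avoids : ∀ {v} → z ≢ σ⁻¹ v → v ≢ σ z
      avoids {v} z≢σ⁻¹v v≡σz = z≢σ⁻¹v (σ-injective (trans (sym v≡σz) (sym (σ∘σ⁻¹ v))))
      f∈ = some-map z y′ (avoids (proj₂ (proj₂ u)))
      g∈ = some-map z y (avoids (proj₁ (proj₂ u)))
      f = proj₁ f∈
      g = proj₁ g∈
      f∈𝒯 = proj₁ (proj₂ f∈)
      g∈𝒯 = proj₁ (proj₂ g∈)
      fz = proj₂ (proj₂ f∈)
      gz = proj₂ (proj₂ g∈)
      F : ∀ a → ∃ λ F → 𝒯 F × (∀ x k → map a x ≡ g k → F x ≡ f k)
      F a = 𝒯-closed f∈𝒯 g∈𝒯 (map-∈ a)

    transfer : ∀ {k x y} → Family k x y → ∀ x′ y′ → Family k x′ y′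
    transfer Φ x′ y′ = retarget-source (retarget-target Φ y′) x′

    extend : ∀ {k x y} (A : Map) → 𝒯 A → A x ≡ y → (Φ : Family k x y) →
             (∀ b → ¬ (∀ z → A z ≡ Family.map Φ b z)) → Family (suc k) x y
    extend {k} {x} {y} A A∈𝒯 Ax≡y Φ A-new = record
      { map = map′ ; map-∈ = map-∈′ ; map-x = map-x′ ; map-distinct = map-distinct′ }
      where
      open Family Φ
      map′ : Fin (suc k) → Map
      map′ zero    = A
      map′ (suc b) = map b
      map-∈′ : ∀ a → 𝒯 (map′ a)
      map-∈′ zero    = A∈𝒯
      map-∈′ (suc b) = map-∈ b
      map-x′ : ∀ a → map′ a x ≡ y
      map-x′ zero    = Ax≡y
      map-x′ (suc b) = map-x b
      map-distinct′ : ∀ {a b} → a ≢ b → ¬ (∀ z → map′ a z ≡ map′ b z)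
      map-distinct′ {zero}  {zero}  a≢b _ = a≢b refl
      map-distinct′ {zero}  {suc b} _ A≗ = A-new b A≗
      map-distinct′ {suc a} {zero}  _ ≗A = A-new a (λ z → sym (≗A z))
      map-distinct′ {suc a} {suc b} a≢b = map-distinct (λ a≡b → a≢b (cong suc a≡b))

    meets-σ⇒≢avoiding : ∀ {A g : Map} → (∃ λ z → A z ≡ σ z) → Avoids σ g → ¬ (∀ z → A z ≡ g z)
    meets-σ⇒≢avoiding (z , Az≡σz) g-avoids A≗g = g-avoids z (trans (sym (A≗g z)) Az≡σz)

    x₁ x₂ x₃ : Fin n
    x₁ = zero
    x₂ = suc zero
    x₃ = suc (suc zero)

    LargeFamily : Set t
    LargeFamily = ∃ λ x → ∃ λ y → y ≢ σ x × Family (4 + q) x y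

    -- A map of a family through (x₁, σ x₁) that differed from σ at some z ≢ x₁ would, together
    -- with the avoiding cover of (z, f z), form a large family; so all its maps agree with σ
    -- at x₂ and x₃ and hence coincide.
    no-large-family⇒⊥ : ¬ LargeFamily → ⊥
    no-large-family⇒⊥ ∄large = map-distinct {zero} {suc zero} (λ ())
      (𝒯-rigid (map-∈ zero) (map-∈ (suc zero)) {x₂} {x₃} (λ ())
        (trans (agrees-with-σ zero x₂ (λ ())) (sym (agrees-with-σ (suc zero) x₂ (λ ()))))
        (trans (agrees-with-σ zero x₃ (λ ())) (sym (agrees-with-σ (suc zero) x₃ (λ ())))))
      where
      y₀ = ∃≢ (σ x₁)
      H = transfer (proj₁ (cover x₁ (proj₁ y₀) (proj₂ y₀))) x₁ (σ x₁)
      open Family H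
      agrees-with-σ : ∀ a z → z ≢ x₁ → map a z ≡ σ z
      agrees-with-σ a z z≢x₁ with map a z ≟ σ z
      ... | yes e = e
      ... | no ne = contradiction (z , map a z , ne , large) ∄large
        where
        C = cover z (map a z) ne
        large = extend (map a) (map-∈ a) refl (proj₁ C)
                  (λ b → meets-σ⇒≢avoiding (x₁ , map-x a) (proj₂ C b))

    attains-all : ∀ {x} (Ψ : Family (4 + q) x (σ x)) {z} → z ≢ x → ∀ w → w ≢ σ x →
                  ∃ λ a → Family.map Ψ a z ≡ w
    attains-all {x} Ψ {z} z≢x w w≢σx with any? (λ a → Family.map Ψ a z ≟ w)
    ... | yes attained = attained
    ... | no ¬attained = contradiction (injective⇒≤ {f = g} g-injective) (ℕ.<-irrefl refl)
      where
      open Family Ψ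
      misses-σx : ∀ a → map a z ≢ σ x
      misses-σx a e = z≢x (𝒯-injective (map-∈ a) (trans e (sym (map-x a))))
      g : Fin (suc n) → Fin n
      g zero          = σ x
      g (suc zero)    = w
      g (suc (suc a)) = map a z
      g-injective : Injective _≡_ _≡_ g
      g-injective {zero}          {zero}          _ = refl
      g-injective {zero}          {suc zero}      e = contradiction (sym e) w≢σx
      g-injective {zero}          {suc (suc b)}   e = contradiction (sym e) (misses-σx b)
      g-injective {suc zero}      {zero}          e = contradiction e w≢σx
      g-injective {suc zero}      {suc zero}      _ = refl
      g-injective {suc zero}      {suc (suc b)}   e = contradiction (b , sym e) ¬attained
      g-injective {suc (suc a)}   {zero}          e = contradiction e (misses-σx a)
      g-injective {suc (suc a)}   {suc zero}      e = contradiction (a , e) ¬attained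
      g-injective {suc (suc a)}   {suc (suc b)}   e with a ≟ b
      ... | yes a≡b = cong (λ c → suc (suc c)) a≡b
      ... | no  a≢b = contradiction e (distinct-at Ψ z≢x a≢b)

    meeting-σ-unique : ∀ w → w ≢ σ x₁ → ∀ {A B} → 𝒯 A → 𝒯 B → A x₁ ≡ w → B x₁ ≡ w →
                       (∃ λ z → A z ≡ σ z) → (∃ λ z → B z ≡ σ z) → ∀ z → A z ≡ B z
    meeting-σ-unique w w≢σx₁ {A} {B} A∈𝒯 B∈𝒯 Ax₁ Bx₁ A-meets B-meets with all? (λ z → A z ≟ B z)
    ... | yes A≗B = A≗B
    ... | no  A≉B = contradiction (extend A A∈𝒯 Ax₁ withB A-new) family-too-large
      where
      C = cover x₁ w w≢σx₁
      B-new : ∀ b → ¬ (∀ z → B z ≡ Family.map (proj₁ C) b z)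
      B-new b = meets-σ⇒≢avoiding B-meets (proj₂ C b)
      withB = extend B B∈𝒯 Bx₁ (proj₁ C) B-new
      A-new : ∀ b → ¬ (∀ z → A z ≡ Family.map withB b z)
      A-new zero    = A≉B
      A-new (suc b) = meets-σ⇒≢avoiding A-meets (proj₂ C b)

    Fixes-x₂-x₃ : Map → Set t
    Fixes-x₂-x₃ A = 𝒯 A × A x₂ ≡ σ x₂ × A x₃ ≡ σ x₃

    fixing-x₂-x₃-unique : ∀ {A B} → Fixes-x₂-x₃ A → Fixes-x₂-x₃ B → A x₁ ≡ B x₁
    fixing-x₂-x₃-unique (A∈𝒯 , Ax₂ , Ax₃) (B∈𝒯 , Bx₂ , Bx₃) =
      𝒯-rigid A∈𝒯 B∈𝒯 {x₂} {x₃} (λ ()) (trans Ax₂ (sym Bx₂)) (trans Ax₃ (sym Bx₃)) x₁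

    σ-x₁x₂x₃ : Fin 3 → Fin n
    σ-x₁x₂x₃ zero             = σ x₁
    σ-x₁x₂x₃ (suc zero)       = σ x₂
    σ-x₁x₂x₃ (suc (suc zero)) = σ x₃

    -- Transferring a large family to (x₂, σ x₂) and to (x₃, σ x₃) yields, for every value v
    -- outside σ {x₁, x₂, x₃}, a map x₁ ↦ v, x₂ ↦ σ x₂, x₃ ↦ σ x₃; by rigidity v is unique,
    -- yet n ≥ 5 leaves two such values.
    large-family⇒⊥ : LargeFamily → ⊥
    large-family⇒⊥ (x , y , _ , Φ) = proj₂ w′ zero (trans (sym Ax₁) (trans (fixing-x₂-x₃-unique A-fixes B-fixes) Bx₁))
      where
      fixing : ∀ v → (∀ i → σ-x₁x₂x₃ i ≢ v) → ∃ λ A → Fixes-x₂-x₃ A × A x₁ ≡ v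
      fixing v fresh = map G₂ a₂ , (map-∈ G₂ a₂ , map-x G₂ a₂ , Ax₃) , G₂x₁
        where
        open Family
        G₂ = transfer Φ x₂ (σ x₂)
        G₃ = transfer Φ x₃ (σ x₃)
        a₂ = proj₁ (attains-all G₂ {x₁} (λ ()) v (λ e → fresh (suc zero) (sym e)))
        G₂x₁ = proj₂ (attains-all G₂ {x₁} (λ ()) v (λ e → fresh (suc zero) (sym e)))
        a₃ = proj₁ (attains-all G₃ {x₁} (λ ()) v (λ e → fresh (suc (suc zero)) (sym e)))
        G₃x₁ = proj₂ (attains-all G₃ {x₁} (λ ()) v (λ e → fresh (suc (suc zero)) (sym e)))
        Ax₃ = trans (meeting-σ-unique v (λ e → fresh zero (sym e)) (map-∈ G₂ a₂) (map-∈ G₃ a₃) G₂x₁ G₃x₁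
                       (x₂ , map-x G₂ a₂) (x₃ , map-x G₃ a₃) x₃)
                    (map-x G₃ a₃)
      w = ∃-missed σ-x₁x₂x₃ (s≤s (s≤s (s≤s (s≤s z≤n))))
      σ-x₁x₂x₃-w : Fin 4 → Fin n
      σ-x₁x₂x₃-w zero    = proj₁ w
      σ-x₁x₂x₃-w (suc i) = σ-x₁x₂x₃ i
      w′ = ∃-missed σ-x₁x₂x₃-w (s≤s (s≤s (s≤s (s≤s (s≤s z≤n)))))
      A-fixing = fixing (proj₁ w) (proj₂ w)
      B-fixing = fixing (proj₁ w′) (λ i → proj₂ w′ (suc i))
      A-fixes = proj₁ (proj₂ A-fixing)
      Ax₁ = proj₂ (proj₂ A-fixing)
      B-fixes = proj₁ (proj₂ B-fixing)
      Bx₁ = proj₂ (proj₂ B-fixing)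

    no-avoiding-cover : ⊥
    no-avoiding-cover = no-large-family⇒⊥ large-family⇒⊥

module IntegerCoefficientSolver {c ℓ} (R : CommutativeRing c ℓ) where

  open import Data.Nat as ℕ using (zero; suc)
  import Data.Nat.Properties as ℕ
  open import Data.Integer as ℤ using (ℤ; +_; -[1+_]; _⊖_)
  import Data.Integer.Properties as ℤ
  open import Data.Sign as Sign using (Sign)
  open import Data.Bool using (Bool; true; false; T)
  open import Data.Maybe using (nothing)
  open import Data.Vec using (Vec)
  import Relation.Binary.PropositionalEquality as ≡
  open import Tactic.RingSolver.Core.AlmostCommutativeRing
    using (AlmostCommutativeRing; fromCommutativeRing)
  open import Tactic.RingSolver.Core.Polynomial.Parameters using (Homomorphism)

  open CommutativeRing R
  open import Algebra.Properties.Monoid.Mult +-monoid using (_×_; ×-homo-+)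
  open import Algebra.Properties.Semiring.Mult semiring using (×1-homo-*)
  open import Algebra.Properties.Ring ring
    using (-‿distribˡ-*; -‿distribʳ-*; -‿involutive; -0#≈0#; -‿+-comm)
  open import Relation.Binary.Reasoning.Setoid setoid

  fromℤ : ℤ → Carrier
  fromℤ (+ n)      = n × 1#
  fromℤ -[1+ n ]   = - (suc n × 1#)

  signed : Sign → Carrier → Carrier
  signed Sign.+ x = x
  signed Sign.- x = - x

  signed-cong : ∀ σ {x y} → x ≈ y → signed σ x ≈ signed σ y
  signed-cong Sign.+ x≈y = x≈y
  signed-cong Sign.- x≈y = -‿cong x≈y

  signed-* : ∀ σ τ x y → signed (σ Sign.* τ) (x * y) ≈ signed σ x * signed τ y
  signed-* Sign.+ Sign.+ x y = refl
  signed-* Sign.+ Sign.- x y = -‿distribʳ-* x y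
  signed-* Sign.- Sign.+ x y = -‿distribˡ-* x y
  signed-* Sign.- Sign.- x y = begin
    x * y         ≈⟨ -‿involutive _ ⟨
    - - (x * y)   ≈⟨ -‿cong (-‿distribˡ-* x y) ⟩
    - (- x * y)   ≈⟨ -‿distribʳ-* (- x) y ⟩
    - x * - y     ∎

  fromℤ-◃ : ∀ σ n → fromℤ (σ ℤ.◃ n) ≈ signed σ (n × 1#)
  fromℤ-◃ Sign.+ zero    = refl
  fromℤ-◃ Sign.- zero    = sym -0#≈0#
  fromℤ-◃ Sign.+ (suc n) = refl
  fromℤ-◃ Sign.- (suc n) = refl

  fromℤ-sign-abs : ∀ i → fromℤ i ≈ signed (ℤ.sign i) (ℤ.∣ i ∣ × 1#)
  fromℤ-sign-abs (+ n)    = refl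
  fromℤ-sign-abs -[1+ n ] = refl

  fromℤ-neg : ∀ i → fromℤ (ℤ.- i) ≈ - fromℤ i
  fromℤ-neg (+ zero)  = sym -0#≈0#
  fromℤ-neg (+ suc n) = refl
  fromℤ-neg -[1+ n ]  = sym (-‿involutive _)

  1+x-[1+y]≈x-y : ∀ x y → (1# + x) - (1# + y) ≈ x - y
  1+x-[1+y]≈x-y x y = begin
    (1# + x) + - (1# + y)    ≈⟨ +-congˡ (-‿+-comm 1# y) ⟨
    (1# + x) + (- 1# + - y)  ≈⟨ +-congʳ (+-comm 1# x) ⟩
    (x + 1#) + (- 1# + - y)  ≈⟨ +-assoc x 1# _ ⟩
    x + (1# + (- 1# + - y))  ≈⟨ +-congˡ (+-assoc 1# (- 1#) (- y)) ⟨
    x + ((1# - 1#) + - y)    ≈⟨ +-congˡ (+-congʳ (-‿inverseʳ 1#)) ⟩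
    x + (0# + - y)           ≈⟨ +-congˡ (+-identityˡ _) ⟩
    x - y                    ∎

  fromℤ-⊖ : ∀ m n → fromℤ (m ⊖ n) ≈ m × 1# - n × 1#
  fromℤ-⊖ m zero = begin
    fromℤ (m ⊖ 0)    ≡⟨ ≡.cong fromℤ (ℤ.⊖-≥ {m} {0} ℕ.z≤n) ⟩
    m × 1#           ≈⟨ +-identityʳ _ ⟨
    m × 1# + 0#      ≈⟨ +-congˡ -0#≈0# ⟨
    m × 1# - 0 × 1#  ∎
  fromℤ-⊖ zero (suc n) = begin
    fromℤ (0 ⊖ suc n)  ≡⟨ ≡.cong fromℤ (ℤ.⊖-≤ {0} {suc n} ℕ.z≤n) ⟩
    - (suc n × 1#)     ≈⟨ +-identityˡ _ ⟨
    0# - suc n × 1#    ∎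
  fromℤ-⊖ (suc m) (suc n) = begin
    fromℤ (suc m ⊖ suc n)      ≡⟨ ≡.cong fromℤ (ℤ.[1+m]⊖[1+n]≡m⊖n m n) ⟩
    fromℤ (m ⊖ n)              ≈⟨ fromℤ-⊖ m n ⟩
    m × 1# - n × 1#            ≈⟨ 1+x-[1+y]≈x-y _ _ ⟨
    suc m × 1# - suc n × 1#    ∎

  fromℤ-+ : ∀ i j → fromℤ (i ℤ.+ j) ≈ fromℤ i + fromℤ j
  fromℤ-+ -[1+ m ] -[1+ n ] = begin
    - (suc (suc (m ℕ.+ n)) × 1#)     ≡⟨ ≡.cong (λ k → - (suc k × 1#)) (ℕ.+-suc m n) ⟨
    - ((suc m ℕ.+ suc n) × 1#)       ≈⟨ -‿cong (×-homo-+ 1# (suc m) (suc n)) ⟩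
    - (suc m × 1# + suc n × 1#)      ≈⟨ -‿+-comm _ _ ⟨
    - (suc m × 1#) + - (suc n × 1#)  ∎
  fromℤ-+ -[1+ m ] (+ n)    = trans (fromℤ-⊖ n (suc m)) (+-comm _ _)
  fromℤ-+ (+ m)    -[1+ n ] = fromℤ-⊖ m (suc n)
  fromℤ-+ (+ m)    (+ n)    = ×-homo-+ 1# m n

  fromℤ-* : ∀ i j → fromℤ (i ℤ.* j) ≈ fromℤ i * fromℤ j
  fromℤ-* i j = begin
    fromℤ (i ℤ.* j)
      ≈⟨ fromℤ-◃ (σ Sign.* τ) (ℤ.∣ i ∣ ℕ.* ℤ.∣ j ∣) ⟩
    signed (σ Sign.* τ) ((ℤ.∣ i ∣ ℕ.* ℤ.∣ j ∣) × 1#)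
      ≈⟨ signed-cong (σ Sign.* τ) (×1-homo-* ℤ.∣ i ∣ ℤ.∣ j ∣) ⟩
    signed (σ Sign.* τ) ((ℤ.∣ i ∣ × 1#) * (ℤ.∣ j ∣ × 1#))
      ≈⟨ signed-* σ τ _ _ ⟩
    signed σ (ℤ.∣ i ∣ × 1#) * signed τ (ℤ.∣ j ∣ × 1#)
      ≈⟨ *-cong (fromℤ-sign-abs i) (fromℤ-sign-abs j) ⟨
    fromℤ i * fromℤ j
      ∎
    where σ = ℤ.sign i; τ = ℤ.sign j

  isZero : ℤ → Bool
  isZero (+ zero) = true
  isZero _        = false

  isZero-sound : ∀ i → T (isZero i) → 0# ≈ fromℤ i
  isZero-sound (+ zero) _ = refl

  almostCommutativeRing : AlmostCommutativeRing c ℓ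
  almostCommutativeRing = fromCommutativeRing R (λ _ → nothing)

  fromℤ-homomorphism : Homomorphism _ _ c ℓ
  fromℤ-homomorphism = record
    { from = record { rawRing = ℤ.+-*-rawRing ; isZero = isZero }
    ; to = almostCommutativeRing
    ; morphism = record
      { ⟦_⟧ = fromℤ ; +-homo = fromℤ-+ ; *-homo = fromℤ-* ; -‿homo = fromℤ-neg
      ; 0-homo = refl ; 1-homo = +-identityʳ 1# }
    ; Zero-C⟶Zero-R = isZero-sound
    }

  open import Tactic.RingSolver.Core.Expression public
  open Eval (AlmostCommutativeRing.rawRing almostCommutativeRing) fromℤ public
  open import Tactic.RingSolver.Core.Polynomial.Base (Homomorphism.from fromℤ-homomorphism)
  open import Tactic.RingSolver.Core.Polynomial.Semantics fromℤ-homomorphism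
    renaming (⟦_⟧ to ⟦_⟧ₚ)
  open import Tactic.RingSolver.Core.Polynomial.Homomorphism fromℤ-homomorphism
  open import Algebra.Properties.Semiring.Exp.TCOptimised (AlmostCommutativeRing.semiring almostCommutativeRing)
    using (^-congˡ)

  normalise : ∀ {n} → Expr ℤ n → Poly n
  normalise (Κ x)   = κ x
  normalise (Ι x)   = ι x
  normalise (x ⊕ y) = normalise x ⊞ normalise y
  normalise (x ⊗ y) = normalise x ⊠ normalise y
  normalise (⊝ x)   = ⊟ normalise x
  normalise (x ⊛ i) = normalise x ⊡ i

  ⟦_⇓⟧ : ∀ {n} → Expr ℤ n → Vec Carrier n → Carrier
  ⟦ e ⇓⟧ = ⟦ normalise e ⟧ₚ

  normalise-correct : ∀ {n} (e : Expr ℤ n) ρ → ⟦ e ⇓⟧ ρ ≈ ⟦ e ⟧ ρ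
  normalise-correct (Κ x)   ρ = κ-hom x ρ
  normalise-correct (Ι x)   ρ = ι-hom x ρ
  normalise-correct (x ⊕ y) ρ =
    trans (⊞-hom (normalise x) (normalise y) ρ) (+-cong (normalise-correct x ρ) (normalise-correct y ρ))
  normalise-correct (x ⊗ y) ρ =
    trans (⊠-hom (normalise x) (normalise y) ρ) (*-cong (normalise-correct x ρ) (normalise-correct y ρ))
  normalise-correct (⊝ x)   ρ = trans (⊟-hom (normalise x) ρ) (-‿cong (normalise-correct x ρ))
  normalise-correct (x ⊛ i) ρ = trans (⊡-hom (normalise x) i ρ) (^-congˡ i (normalise-correct x ρ))

  open import Relation.Binary.Reflection setoid Ι ⟦_⟧ ⟦_⇓⟧ normalise-correct public
    using (solve; _⊜_)

module Vec3Algebra {a ℓ} (R : RawRing a ℓ) where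

  open RawRing R using (Carrier; _+_; _*_; -_)
  private A = Carrier

  infixl 6 _⊹_
  infixr 7 _·_

  vec : A → A → A → Fin 3 → A
  vec x y z zero             = x
  vec x y z (suc zero)       = y
  vec x y z (suc (suc zero)) = z

  dot : (Fin 3 → A) → (Fin 3 → A) → A
  dot u v = u zero * v zero + u (suc zero) * v (suc zero) + u (suc (suc zero)) * v (suc (suc zero))

  cross : (Fin 3 → A) → (Fin 3 → A) → Fin 3 → A
  cross u v zero             = u (suc zero) * v (suc (suc zero)) + - (u (suc (suc zero)) * v (suc zero))
  cross u v (suc zero)       = u (suc (suc zero)) * v zero + - (u zero * v (suc (suc zero)))
  cross u v (suc (suc zero)) = u zero * v (suc zero) + - (u (suc zero) * v zero)

  det : (Fin 3 → A) → (Fin 3 → A) → (Fin 3 → A) → A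
  det u v w = dot u (cross v w)

  _·_ : A → (Fin 3 → A) → Fin 3 → A
  (k · v) i = k * v i

  _⊹_ : (Fin 3 → A) → (Fin 3 → A) → Fin 3 → A
  (u ⊹ v) i = u i + v i

module Vec3Identities {c ℓ} (R : CommutativeRing c ℓ) where

  open import Level using (0ℓ)
  open import Data.Product using (_×_)
  open import Data.Vec.N-ary using (N-ary)
  import Data.Integer as ℤ
  import Relation.Binary.PropositionalEquality as ≡

  open CommutativeRing R hiding (zero)
  open IntegerCoefficientSolver R using (Expr; Κ; solve; _⊜_; _⊕_; _⊗_; ⊝_)
  open Vec3Algebra rawRing public

  Vec3 : Set c
  Vec3 = Fin 3 → Carrier

  private
    exprRawRing : ∀ n → RawRing 0ℓ 0ℓ
    exprRawRing n = record
      { Carrier = Expr ℤ.ℤ n ; _≈_ = ≡._≡_ ; _+_ = _⊕_ ; _*_ = _⊗_ ; -_ = ⊝_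
      ; 0# = Κ (ℤ.+ 0) ; 1# = Κ (ℤ.+ 1) }

    -- Vector operations on solver expressions, so that each vector identity below is stated
    -- once and checked coordinatewise by the solver.
    module ₑ {n} = Vec3Algebra (exprRawRing n)

    Identity : (n : ℕ) → Set _
    Identity n = N-ary n (Expr ℤ.ℤ n) (Expr ℤ.ℤ n × Expr ℤ.ℤ n)

    cramerₑ : Fin 3 → Identity 12
    cramerₑ i l₀ l₁ l₂ m₀ m₁ m₂ e₀ e₁ e₂ x₀ x₁ x₂ =
      ₑ.det l m e ⊗ x i ⊜ ₑ.dot l x ⊗ ₑ.cross m e i ⊕ ₑ.dot m x ⊗ ₑ.cross e l i ⊕ ₑ.dot e x ⊗ ₑ.cross l m i
      where l = ₑ.vec l₀ l₁ l₂; m = ₑ.vec m₀ m₁ m₂; e = ₑ.vec e₀ e₁ e₂; x = ₑ.vec x₀ x₁ x₂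

    cross-crossₑ : Fin 3 → Identity 9
    cross-crossₑ i l₀ l₁ l₂ m₀ m₁ m₂ x₀ x₁ x₂ =
      ₑ.cross (ₑ.cross l m) x i ⊜ m i ⊗ ₑ.dot l x ⊕ ⊝ (l i ⊗ ₑ.dot m x)
      where l = ₑ.vec l₀ l₁ l₂; m = ₑ.vec m₀ m₁ m₂; x = ₑ.vec x₀ x₁ x₂

  cramer : ∀ l m e x i →
           det l m e * x i ≈ dot l x * cross m e i + dot m x * cross e l i + dot e x * cross l m i
  cramer l m e x zero             = solve 12 (cramerₑ zero) refl _ _ _ _ _ _ _ _ _ _ _ _
  cramer l m e x (suc zero)       = solve 12 (cramerₑ (suc zero)) refl _ _ _ _ _ _ _ _ _ _ _ _
  cramer l m e x (suc (suc zero)) = solve 12 (cramerₑ (suc (suc zero))) refl _ _ _ _ _ _ _ _ _ _ _ _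

  dot-comm : ∀ u v → dot u v ≈ dot v u
  dot-comm u v = solve 6 (λ u₀ u₁ u₂ v₀ v₁ v₂ →
    ₑ.dot (ₑ.vec u₀ u₁ u₂) (ₑ.vec v₀ v₁ v₂) ⊜ ₑ.dot (ₑ.vec v₀ v₁ v₂) (ₑ.vec u₀ u₁ u₂)) refl _ _ _ _ _ _

  det≈dot-cross : ∀ u v w → det u v w ≈ dot (cross u v) w
  det≈dot-cross u v w = solve 9 (λ u₀ u₁ u₂ v₀ v₁ v₂ w₀ w₁ w₂ →
    let u = ₑ.vec u₀ u₁ u₂; v = ₑ.vec v₀ v₁ v₂; w = ₑ.vec w₀ w₁ w₂ in
    ₑ.det u v w ⊜ ₑ.dot (ₑ.cross u v) w) refl _ _ _ _ _ _ _ _ _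

  det-swap : ∀ u v w → det v u w ≈ - det u v w
  det-swap u v w = solve 9 (λ u₀ u₁ u₂ v₀ v₁ v₂ w₀ w₁ w₂ →
    let u = ₑ.vec u₀ u₁ u₂; v = ₑ.vec v₀ v₁ v₂; w = ₑ.vec w₀ w₁ w₂ in
    ₑ.det v u w ⊜ ⊝ ₑ.det u v w) refl _ _ _ _ _ _ _ _ _

  det-scale : ∀ α β u v w → det (α · u) v (β · w) ≈ α * β * det u v w
  det-scale α β u v w = solve 11 (λ α β u₀ u₁ u₂ v₀ v₁ v₂ w₀ w₁ w₂ →
    let u = ₑ.vec u₀ u₁ u₂; v = ₑ.vec v₀ v₁ v₂; w = ₑ.vec w₀ w₁ w₂ in
    ₑ.det (α ₑ.· u) v (β ₑ.· w) ⊜ α ⊗ β ⊗ ₑ.det u v w) refl _ _ _ _ _ _ _ _ _ _ _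

  det-bilinear : ∀ a b u o v p w →
    det (u ⊹ a · o) v (w ⊹ b · p) ≈ det u v w + b * det u v p + a * det o v w + a * b * det o v p
  det-bilinear a b u o v p w = solve 17 (λ a b u₀ u₁ u₂ o₀ o₁ o₂ v₀ v₁ v₂ p₀ p₁ p₂ w₀ w₁ w₂ →
    let u = ₑ.vec u₀ u₁ u₂; o = ₑ.vec o₀ o₁ o₂; v = ₑ.vec v₀ v₁ v₂
        p = ₑ.vec p₀ p₁ p₂; w = ₑ.vec w₀ w₁ w₂ in
    ₑ.det (u ₑ.⊹ a ₑ.· o) v (w ₑ.⊹ b ₑ.· p)
      ⊜ ₑ.det u v w ⊕ b ⊗ ₑ.det u v p ⊕ a ⊗ ₑ.det o v w ⊕ a ⊗ b ⊗ ₑ.det o v p)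
    refl _ _ _ _ _ _ _ _ _ _ _ _ _ _ _ _ _

  det-cross-cross-swap : ∀ l m q → det (cross l m) q (cross m l) ≈ 0#
  det-cross-cross-swap l m q = solve 9 (λ l₀ l₁ l₂ m₀ m₁ m₂ q₀ q₁ q₂ →
    let l = ₑ.vec l₀ l₁ l₂; m = ₑ.vec m₀ m₁ m₂; q = ₑ.vec q₀ q₁ q₂ in
    ₑ.det (ₑ.cross l m) q (ₑ.cross m l) ⊜ Κ (ℤ.+ 0)) refl _ _ _ _ _ _ _ _ _

  det-cross-cross : ∀ l m e q → det (cross e l) q (cross m l) ≈ det l m e * dot l q
  det-cross-cross l m e q = solve 12 (λ l₀ l₁ l₂ m₀ m₁ m₂ e₀ e₁ e₂ q₀ q₁ q₂ →
    let l = ₑ.vec l₀ l₁ l₂; m = ₑ.vec m₀ m₁ m₂; e = ₑ.vec e₀ e₁ e₂; q = ₑ.vec q₀ q₁ q₂ in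
    ₑ.det (ₑ.cross e l) q (ₑ.cross m l) ⊜ ₑ.det l m e ⊗ ₑ.dot l q) refl _ _ _ _ _ _ _ _ _ _ _ _

  cross-cross : ∀ l m x i → cross (cross l m) x i ≈ m i * dot l x - l i * dot m x
  cross-cross l m x zero             = solve 9 (cross-crossₑ zero) refl _ _ _ _ _ _ _ _ _
  cross-cross l m x (suc zero)       = solve 9 (cross-crossₑ (suc zero)) refl _ _ _ _ _ _ _ _ _
  cross-cross l m x (suc (suc zero)) = solve 9 (cross-crossₑ (suc (suc zero))) refl _ _ _ _ _ _ _ _ _

¬¬-∀-Fin : ∀ {p} {n} {P : Fin n → Set p} → (∀ i → ¬ ¬ P i) → ¬ ¬ (∀ i → P i)
¬¬-∀-Fin {n = zero}  ¬¬P ¬∀P = ¬∀P (λ ())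
¬¬-∀-Fin {n = suc n} ¬¬P ¬∀P = ¬¬P zero λ P₀ →
  ¬¬-∀-Fin (λ i → ¬¬P (suc i)) λ P₊ → ¬∀P λ { zero → P₀ ; (suc i) → P₊ i }

module FieldArithmetic {c ℓ} (F : FiniteField c ℓ) where

  open import Data.Product using (proj₁; proj₂)

  open FiniteField F hiding (zero)
  open import Relation.Binary.Reasoning.Setoid setoid
  open IntegerCoefficientSolver commRing using (solve; _⊜_; _⊕_; _⊗_; ⊝_)

  inv : ∀ x → ¬ x ≈ 0# → Carrier
  inv x x≉0 = proj₁ (inverse x x≉0)

  *-inverseʳ : ∀ x (x≉0 : ¬ x ≈ 0#) → x * inv x x≉0 ≈ 1#
  *-inverseʳ x x≉0 = proj₂ (inverse x x≉0)

  *-inverseˡ : ∀ x (x≉0 : ¬ x ≈ 0#) → inv x x≉0 * x ≈ 1#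
  *-inverseˡ x x≉0 = trans (*-comm _ x) (*-inverseʳ x x≉0)

  inv-nonzero : ∀ x (x≉0 : ¬ x ≈ 0#) → ¬ inv x x≉0 ≈ 0#
  inv-nonzero x x≉0 x⁻¹≈0 = 1≉0 (begin
    1#               ≈⟨ *-inverseʳ x x≉0 ⟨
    x * inv x x≉0    ≈⟨ *-congˡ x⁻¹≈0 ⟩
    x * 0#           ≈⟨ zeroʳ x ⟩
    0#               ∎)

  x*y≈0⇒y≈0 : ∀ {x y} → ¬ x ≈ 0# → x * y ≈ 0# → y ≈ 0#
  x*y≈0⇒y≈0 {x} {y} x≉0 xy≈0 = begin
    y                    ≈⟨ *-identityˡ y ⟨
    1# * y               ≈⟨ *-congʳ (*-inverseˡ x x≉0) ⟨
    (inv x x≉0 * x) * y  ≈⟨ *-assoc _ x y ⟩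
    inv x x≉0 * (x * y)  ≈⟨ *-congˡ xy≈0 ⟩
    inv x x≉0 * 0#       ≈⟨ zeroʳ _ ⟩
    0#                   ∎

  *-nonzero : ∀ {x y} → ¬ x ≈ 0# → ¬ y ≈ 0# → ¬ x * y ≈ 0#
  *-nonzero x≉0 y≉0 xy≈0 = y≉0 (x*y≈0⇒y≈0 x≉0 xy≈0)

  x-y≈0⇒x≈y : ∀ {x y} → x - y ≈ 0# → x ≈ y
  x-y≈0⇒x≈y {x} {y} x-y≈0 = begin
    x              ≈⟨ solve 2 (λ x y → x ⊜ (x ⊕ ⊝ y) ⊕ y) refl x y ⟩
    (x - y) + y    ≈⟨ +-congʳ x-y≈0 ⟩
    0# + y         ≈⟨ +-identityˡ y ⟩
    y              ∎

  *-cancelˡ-nonzero : ∀ {x y z} → ¬ x ≈ 0# → x * y ≈ x * z → y ≈ z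
  *-cancelˡ-nonzero {x} {y} {z} x≉0 xy≈xz = x-y≈0⇒x≈y (x*y≈0⇒y≈0 x≉0 (begin
    x * (y - z)       ≈⟨ solve 3 (λ x y z → x ⊗ (y ⊕ ⊝ z) ⊜ x ⊗ y ⊕ ⊝ (x ⊗ z)) refl x y z ⟩
    x * y - x * z     ≈⟨ +-congʳ xy≈xz ⟩
    x * z - x * z     ≈⟨ -‿inverseʳ (x * z) ⟩
    0#                ∎))

  +-cancelʳ : ∀ {x y z} → x + z ≈ y + z → x ≈ y
  +-cancelʳ {x} {y} {z} e = x-y≈0⇒x≈y (begin
    x - y                  ≈⟨ solve 3 (λ x y z → x ⊕ ⊝ y ⊜ (x ⊕ z) ⊕ ⊝ (y ⊕ z)) refl x y z ⟩
    (x + z) - (y + z)      ≈⟨ +-congʳ e ⟩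
    (y + z) - (y + z)      ≈⟨ -‿inverseʳ _ ⟩
    0#                     ∎)

  x*[y*x⁻¹]≈y : ∀ x y (x≉0 : ¬ x ≈ 0#) → x * (y * inv x x≉0) ≈ y
  x*[y*x⁻¹]≈y x y x≉0 = begin
    x * (y * inv x x≉0)    ≈⟨ solve 3 (λ x y i → x ⊗ (y ⊗ i) ⊜ (x ⊗ i) ⊗ y) refl x y _ ⟩
    (x * inv x x≉0) * y    ≈⟨ *-congʳ (*-inverseʳ x x≉0) ⟩
    1# * y                 ≈⟨ *-identityˡ y ⟩
    y                      ∎

  affine-root : ∀ {a b d k k′} (d≉0 : ¬ d ≈ 0#) → k + b * d + a * k′ ≈ 0# →
                b ≈ (- k′ * inv d d≉0) * a + - k * inv d d≉0
  affine-root {a} {b} {d} {k} {k′} d≉0 root = begin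
    b                                                            ≈⟨ *-identityʳ b ⟨
    b * 1#                                                       ≈⟨ *-congˡ (*-inverseʳ d d≉0) ⟨
    b * (d * d⁻¹)                                                ≈⟨ rearrange ⟩
    (- k′ * d⁻¹) * a + - k * d⁻¹ + d⁻¹ * (k + b * d + a * k′)    ≈⟨ +-congˡ (*-congˡ root) ⟩
    (- k′ * d⁻¹) * a + - k * d⁻¹ + d⁻¹ * 0#                      ≈⟨ +-congˡ (zeroʳ d⁻¹) ⟩
    (- k′ * d⁻¹) * a + - k * d⁻¹ + 0#                            ≈⟨ +-identityʳ _ ⟩
    (- k′ * d⁻¹) * a + - k * d⁻¹                                 ∎
    where
    d⁻¹ = inv d d≉0
    rearrange : b * (d * d⁻¹) ≈ (- k′ * d⁻¹) * a + - k * d⁻¹ + d⁻¹ * (k + b * d + a * k′)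
    rearrange = solve 6 (λ a b d d⁻¹ k k′ →
      b ⊗ (d ⊗ d⁻¹) ⊜ (⊝ k′ ⊗ d⁻¹) ⊗ a ⊕ ⊝ k ⊗ d⁻¹ ⊕ d⁻¹ ⊗ (k ⊕ b ⊗ d ⊕ a ⊗ k′)) refl a b d d⁻¹ k k′

module PlaneGeometry {c ℓ} (F : FiniteField c ℓ) where

  open import Data.Product using (∃; ∃₂; _,_)
  import Data.Integer as ℤ

  open FiniteField F hiding (zero)
  open FieldArithmetic F
  open Vec3Identities commRing
  open PG2 F using (Nonzero; Proportional)
  open IntegerCoefficientSolver commRing using (solve; _⊜_; _⊕_; _⊗_; ⊝_; Κ)
  open import Relation.Binary.Reasoning.Setoid setoid

  infix 4 _≋_
  _≋_ : Vec3 → Vec3 → Set ℓ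
  u ≋ v = ∀ i → u i ≈ v i

  det-cong : ∀ x x′ q y y′ → x ≋ x′ → y ≋ y′ → det x q y ≈ det x′ q y′
  det-cong _ _ _ _ _ x≋x′ y≋y′ =
    +-cong (+-cong (*-cong (x≋x′ zero) (+-cong (*-congˡ (y≋y′ (suc (suc zero)))) (-‿cong (*-congˡ (y≋y′ (suc zero))))))
                   (*-cong (x≋x′ (suc zero)) (+-cong (*-congˡ (y≋y′ zero)) (-‿cong (*-congˡ (y≋y′ (suc (suc zero))))))))
           (*-cong (x≋x′ (suc (suc zero))) (+-cong (*-congˡ (y≋y′ (suc zero))) (-‿cong (*-congˡ (y≋y′ zero)))))

  basis : Fin 3 → Vec3
  basis zero             = vec 1# 0# 0#
  basis (suc zero)       = vec 0# 1# 0#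
  basis (suc (suc zero)) = vec 0# 0# 1#

  dot-basis : ∀ u j → dot u (basis j) ≈ u j
  dot-basis u zero = begin
    u zero * 1# + u (suc zero) * 0# + u (suc (suc zero)) * 0#
      ≈⟨ +-cong (+-cong (*-identityʳ _) (zeroʳ _)) (zeroʳ _) ⟩
    u zero + 0# + 0#     ≈⟨ trans (+-identityʳ _) (+-identityʳ _) ⟩
    u zero               ∎
  dot-basis u (suc zero) = begin
    u zero * 0# + u (suc zero) * 1# + u (suc (suc zero)) * 0#
      ≈⟨ +-cong (+-cong (zeroʳ _) (*-identityʳ _)) (zeroʳ _) ⟩
    0# + u (suc zero) + 0#   ≈⟨ trans (+-identityʳ _) (+-identityˡ _) ⟩
    u (suc zero)             ∎
  dot-basis u (suc (suc zero)) = begin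
    u zero * 0# + u (suc zero) * 0# + u (suc (suc zero)) * 1#
      ≈⟨ +-cong (+-cong (zeroʳ _) (zeroʳ _)) (*-identityʳ _) ⟩
    0# + 0# + u (suc (suc zero))   ≈⟨ trans (+-congʳ (+-identityʳ _)) (+-identityˡ _) ⟩
    u (suc (suc zero))             ∎

  -- An affine coordinate on a line l: the point l ∩ m goes to infinity, which makes every
  -- perspectivity between l and m an affine map.
  coordinate : (m e x : Vec3) → ¬ dot m x ≈ 0# → Carrier
  coordinate m e x mx≉0 = dot e x * inv (dot m x) mx≉0

  parametrisation : ∀ l m e x → dot l x ≈ 0# → (mx≉0 : ¬ dot m x ≈ 0#) →
    det l m e · x ≋ dot m x · (cross e l ⊹ coordinate m e x mx≉0 · cross l m)
  parametrisation l m e x lx≈0 mx≉0 i = begin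
    det l m e * x i
      ≈⟨ cramer l m e x i ⟩
    dot l x * cross m e i + dot m x * cross e l i + dot e x * cross l m i
      ≈⟨ +-cong (+-congʳ (*-congʳ lx≈0)) (*-congʳ (sym (x*[y*x⁻¹]≈y (dot m x) (dot e x) mx≉0))) ⟩
    0# * cross m e i + dot m x * cross e l i + dot m x * a * cross l m i
      ≈⟨ solve 5 (λ A λ′ B a C → Κ (ℤ.+ 0) ⊗ A ⊕ λ′ ⊗ B ⊕ λ′ ⊗ a ⊗ C ⊜ λ′ ⊗ (B ⊕ a ⊗ C))
           refl _ _ _ _ _ ⟩
    dot m x * (cross e l i + a * cross l m i)
      ∎
    where a = coordinate m e x mx≉0

  coordinate-injective : ∀ l m e x x′ → ¬ det l m e ≈ 0# → dot l x ≈ 0# → dot l x′ ≈ 0# →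
    (mx≉0 : ¬ dot m x ≈ 0#) (mx′≉0 : ¬ dot m x′ ≈ 0#) →
    coordinate m e x mx≉0 ≈ coordinate m e x′ mx′≉0 → Proportional x x′
  coordinate-injective l m e x x′ D≉0 lx≈0 lx′≈0 mx≉0 mx′≉0 a≈a′ =
    k , λ i → *-cancelˡ-nonzero D≉0 (begin
      det l m e * x i          ≈⟨ parametrisation l m e x lx≈0 mx≉0 i ⟩
      λ₁ * w i                 ≈⟨ *-congˡ (+-congˡ (*-congʳ a≈a′)) ⟩
      λ₁ * w′ i                ≈⟨ *-congʳ (x*[y*x⁻¹]≈y λ₂ λ₁ mx′≉0) ⟨
      λ₂ * k * w′ i            ≈⟨ solve 3 (λ λ₂ k w → λ₂ ⊗ k ⊗ w ⊜ k ⊗ (λ₂ ⊗ w)) refl λ₂ k (w′ i) ⟩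
      k * (λ₂ * w′ i)          ≈⟨ *-congˡ (parametrisation l m e x′ lx′≈0 mx′≉0 i) ⟨
      k * (det l m e * x′ i)   ≈⟨ solve 3 (λ k D x → k ⊗ (D ⊗ x) ⊜ D ⊗ (k ⊗ x)) refl k _ (x′ i) ⟩
      det l m e * (k * x′ i)   ∎)
    where
    λ₁ = dot m x
    λ₂ = dot m x′
    k = λ₁ * inv λ₂ mx′≉0
    w = cross e l ⊹ coordinate m e x mx≉0 · cross l m
    w′ = cross e l ⊹ coordinate m e x′ mx′≉0 · cross l m

  concurrent⇒det≈0 : ∀ x q y n → Nonzero n → dot n x ≈ 0# → dot n q ≈ 0# → dot n y ≈ 0# →
                     ¬ ¬ det x q y ≈ 0#
  concurrent⇒det≈0 x q y n n≉0 nx≈0 nq≈0 ny≈0 det≉0 = n≉0 λ i → x*y≈0⇒y≈0 det≉0 (begin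
    det x q y * n i
      ≈⟨ cramer x q y n i ⟩
    dot x n * cross q y i + dot q n * cross y x i + dot y n * cross x q i
      ≈⟨ +-cong (+-cong (*-congʳ (vanishes x nx≈0)) (*-congʳ (vanishes q nq≈0))) (*-congʳ (vanishes y ny≈0)) ⟩
    0# * cross q y i + 0# * cross y x i + 0# * cross x q i
      ≈⟨ solve 3 (λ A B C → Κ (ℤ.+ 0) ⊗ A ⊕ Κ (ℤ.+ 0) ⊗ B ⊕ Κ (ℤ.+ 0) ⊗ C ⊜ Κ (ℤ.+ 0)) refl _ _ _ ⟩
    0# ∎)
    where
    vanishes : ∀ u → dot n u ≈ 0# → dot u n ≈ 0#
    vanishes u nu≈0 = trans (dot-comm u n) nu≈0

  perspectivity-affine : ∀ l m e q → ¬ det l m e ≈ 0# → ¬ dot l q ≈ 0# →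
    ∃₂ λ μ κ → ∀ x y → dot l x ≈ 0# → (mx≉0 : ¬ dot m x ≈ 0#) → dot m y ≈ 0# → (ly≉0 : ¬ dot l y ≈ 0#) →
      det x q y ≈ 0# → coordinate l e y ly≉0 ≈ μ * coordinate m e x mx≉0 + κ
  perspectivity-affine l m e q D≉0 lq≉0 =
    _ , _ , λ x y lx≈0 mx≉0 my≈0 ly≉0 xqy≈0 →
      affine-root (*-nonzero D≉0 lq≉0) (root x y lx≈0 mx≉0 my≈0 ly≉0 xqy≈0)
    where
    K₀ = det (cross e l) q (cross e m)
    K₁ = det (cross l m) q (cross e m)
    root : ∀ x y → dot l x ≈ 0# → (mx≉0 : ¬ dot m x ≈ 0#) → dot m y ≈ 0# → (ly≉0 : ¬ dot l y ≈ 0#) →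
           det x q y ≈ 0# →
           K₀ + coordinate l e y ly≉0 * (det l m e * dot l q) + coordinate m e x mx≉0 * K₁ ≈ 0#
    root x y lx≈0 mx≉0 my≈0 ly≉0 xqy≈0 = begin
      K₀ + b * (det l m e * dot l q) + a * K₁
        ≈⟨ solve 4 (λ K₀ B K₁ ab → K₀ ⊕ B ⊕ K₁ ⊜ K₀ ⊕ B ⊕ K₁ ⊕ ab ⊗ Κ (ℤ.+ 0))
             refl K₀ _ _ (a * b) ⟩
      K₀ + b * (det l m e * dot l q) + a * K₁ + a * b * 0#
        ≈⟨ +-cong (+-congʳ (+-congˡ (*-congˡ (det-cross-cross l m e q)))) (*-congˡ (det-cross-cross-swap l m q)) ⟨
      K₀ + b * det (cross e l) q (cross m l) + a * K₁ + a * b * det (cross l m) q (cross m l)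
        ≈⟨ det-bilinear a b (cross e l) (cross l m) q (cross m l) (cross e m) ⟨
      det w q w′
        ≈⟨ x*y≈0⇒y≈0 (*-nonzero mx≉0 ly≉0) scaled ⟩
      0# ∎
      where
      a = coordinate m e x mx≉0
      b = coordinate l e y ly≉0
      w = cross e l ⊹ a · cross l m
      w′ = cross e m ⊹ b · cross m l
      scaled : dot m x * dot l y * det w q w′ ≈ 0#
      scaled = begin
        dot m x * dot l y * det w q w′
          ≈⟨ det-scale (dot m x) (dot l y) w q w′ ⟨
        det (dot m x · w) q (dot l y · w′)
          ≈⟨ det-cong _ _ q _ _ (parametrisation l m e x lx≈0 mx≉0) (parametrisation m l e y my≈0 ly≉0) ⟨
        det (det l m e · x) q (det m l e · y)
          ≈⟨ det-scale (det l m e) (det m l e) x q y ⟩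
        det l m e * det m l e * det x q y
          ≈⟨ *-congˡ xqy≈0 ⟩
        det l m e * det m l e * 0#
          ≈⟨ zeroʳ _ ⟩
        0# ∎

  x≈0∧y≈0⇒x*z-y*w≈0 : ∀ {x y} z w → x ≈ 0# → y ≈ 0# → x * z - y * w ≈ 0#
  x≈0∧y≈0⇒x*z-y*w≈0 z w x≈0 y≈0 = begin
    _ * z - _ * w      ≈⟨ +-cong (*-congʳ x≈0) (-‿cong (*-congʳ y≈0)) ⟩
    0# * z - 0# * w    ≈⟨ solve 2 (λ z w → Κ (ℤ.+ 0) ⊗ z ⊕ ⊝ (Κ (ℤ.+ 0) ⊗ w) ⊜ Κ (ℤ.+ 0)) refl z w ⟩
    0#                 ∎

  cross-zeroˡ : ∀ u v → (∀ j → u j ≈ 0#) → ∀ i → cross u v i ≈ 0#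
  cross-zeroˡ u v u≈0 zero             = x≈0∧y≈0⇒x*z-y*w≈0 _ _ (u≈0 (suc zero)) (u≈0 (suc (suc zero)))
  cross-zeroˡ u v u≈0 (suc zero)       = x≈0∧y≈0⇒x*z-y*w≈0 _ _ (u≈0 (suc (suc zero))) (u≈0 zero)
  cross-zeroˡ u v u≈0 (suc (suc zero)) = x≈0∧y≈0⇒x*z-y*w≈0 _ _ (u≈0 zero) (u≈0 (suc zero))

  cross≈0⇒≈0 : ∀ l m x → (∀ j → cross l m j ≈ 0#) → dot l x ≈ 0# → ¬ dot m x ≈ 0# → ∀ i → l i ≈ 0#
  cross≈0⇒≈0 l m x l×m≈0 lx≈0 mx≉0 i = x*y≈0⇒y≈0 mx≉0 (begin
    dot m x * l i
      ≈⟨ solve 2 (λ mx li → mx ⊗ li ⊜ ⊝ (Κ (ℤ.+ 0) ⊕ ⊝ (li ⊗ mx))) refl _ (l i) ⟩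
    - (0# - l i * dot m x)
      ≈⟨ -‿cong (+-congʳ (zeroʳ (m i))) ⟨
    - (m i * 0# - l i * dot m x)
      ≈⟨ -‿cong (+-congʳ (*-congˡ lx≈0)) ⟨
    - (m i * dot l x - l i * dot m x)
      ≈⟨ -‿cong (cross-cross l m x i) ⟨
    - cross (cross l m) x i
      ≈⟨ -‿cong (cross-zeroˡ (cross l m) x l×m≈0 i) ⟩
    - 0#
      ≈⟨ solve 0 (⊝ Κ (ℤ.+ 0) ⊜ Κ (ℤ.+ 0)) refl ⟩
    0# ∎)

  exists-transversal : ∀ l m x → Nonzero l → dot l x ≈ 0# → ¬ dot m x ≈ 0# →
                       ¬ ¬ ∃ λ e → ¬ det l m e ≈ 0#
  exists-transversal l m x l≉0 lx≈0 mx≉0 ∄e =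
    ¬¬-∀-Fin (λ j l×mⱼ≉0 → ∄e (basis j , λ D≈0 → l×mⱼ≉0 (begin
                cross l m j                ≈⟨ dot-basis (cross l m) j ⟨
                dot (cross l m) (basis j)  ≈⟨ det≈dot-cross l m (basis j) ⟨
                det l m (basis j)          ≈⟨ D≈0 ⟩
                0#                         ∎)))
             (λ l×m≈0 → l≉0 (cross≈0⇒≈0 l m x l×m≈0 lx≈0 mx≉0))

  det-swap-nonzero : ∀ l m e → ¬ det l m e ≈ 0# → ¬ det m l e ≈ 0#
  det-swap-nonzero l m e D≉0 D′≈0 = D≉0 (begin
    det l m e          ≈⟨ solve 1 (λ D → D ⊜ ⊝ (⊝ D)) refl _ ⟩
    - - det l m e      ≈⟨ -‿cong (det-swap l m e) ⟨
    - det m l e        ≈⟨ -‿cong D′≈0 ⟩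
    - 0#               ≈⟨ solve 0 (⊝ Κ (ℤ.+ 0) ⊜ Κ (ℤ.+ 0)) refl ⟩
    0#                 ∎)

module AffineMaps {c ℓ} (F : FiniteField c ℓ) {n : ℕ} (a b : Fin n → FiniteField.Carrier F)
  (a-injective : Injective _≡_ (FiniteField._≈_ F) a)
  (b-injective : Injective _≡_ (FiniteField._≈_ F) b) where

  open import Level using (_⊔_)
  open import Data.Product using (∃; ∃₂; _×_; _,_; proj₁; proj₂)
  open import Relation.Binary.PropositionalEquality as ≡ using (_≢_)

  open FiniteField F hiding (zero)
  open FieldArithmetic F
  open IntegerCoefficientSolver commRing using (solve; _⊜_; _⊕_; _⊗_; ⊝_)
  open FiniteSets using (injective⇒surjective)
  open import Relation.Binary.Reasoning.Setoid setoid

  IsAffine : (Fin n → Fin n) → Set (c ⊔ ℓ)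
  IsAffine τ = ∃₂ λ μ κ → ¬ μ ≈ 0# × (∀ i → μ * a i + κ ≈ b (τ i))

  affine-injective : ∀ {τ} → IsAffine τ → Injective _≡_ _≡_ τ
  affine-injective {τ} (μ , κ , μ≉0 , τ-eq) {i} {j} τi≡τj =
    a-injective (*-cancelˡ-nonzero μ≉0 (+-cancelʳ (begin
      μ * a i + κ   ≈⟨ τ-eq i ⟩
      b (τ i)       ≡⟨ ≡.cong b τi≡τj ⟩
      b (τ j)       ≈⟨ τ-eq j ⟨
      μ * a j + κ   ∎)))

  affine-rigid : ∀ {τ τ′} → IsAffine τ → IsAffine τ′ → ∀ {i j} → i ≢ j →
                 τ i ≡ τ′ i → τ j ≡ τ′ j → ∀ z → τ z ≡ τ′ z
  affine-rigid {τ} {τ′} (μ , κ , _ , τ-eq) (μ′ , κ′ , _ , τ′-eq) {i} {j} i≢j τi≡τ′i τj≡τ′j z =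
    b-injective (begin
      b (τ z)          ≈⟨ τ-eq z ⟨
      μ * a z + κ      ≈⟨ +-cong (*-congʳ μ≈μ′) κ≈κ′ ⟩
      μ′ * a z + κ′    ≈⟨ τ′-eq z ⟩
      b (τ′ z)         ∎)
    where
    agree : ∀ {k} → τ k ≡ τ′ k → μ * a k + κ ≈ μ′ * a k + κ′
    agree {k} τk≡τ′k = trans (τ-eq k) (trans (reflexive (≡.cong b τk≡τ′k)) (sym (τ′-eq k)))
    difference : ∀ μ κ → (μ * a i + κ) - (μ * a j + κ) ≈ (a i - a j) * μ
    difference μ κ =
      solve 4 (λ μ κ x y → (μ ⊗ x ⊕ κ) ⊕ ⊝ (μ ⊗ y ⊕ κ) ⊜ (x ⊕ ⊝ y) ⊗ μ) refl μ κ (a i) (a j)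
    aᵢ-aⱼ≉0 : ¬ a i - a j ≈ 0#
    aᵢ-aⱼ≉0 aᵢ-aⱼ≈0 = i≢j (a-injective (x-y≈0⇒x≈y aᵢ-aⱼ≈0))
    μ≈μ′ : μ ≈ μ′
    μ≈μ′ = *-cancelˡ-nonzero aᵢ-aⱼ≉0 (begin
      (a i - a j) * μ                      ≈⟨ difference μ κ ⟨
      (μ * a i + κ) - (μ * a j + κ)        ≈⟨ +-cong (agree τi≡τ′i) (-‿cong (agree τj≡τ′j)) ⟩
      (μ′ * a i + κ′) - (μ′ * a j + κ′)    ≈⟨ difference μ′ κ′ ⟩
      (a i - a j) * μ′                     ∎)
    κ≈κ′ : κ ≈ κ′
    κ≈κ′ = +-cancelʳ (begin
      κ + μ * a i      ≈⟨ +-comm κ _ ⟩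
      μ * a i + κ      ≈⟨ agree τi≡τ′i ⟩
      μ′ * a i + κ′    ≈⟨ +-congʳ (*-congʳ μ≈μ′) ⟨
      μ * a i + κ′     ≈⟨ +-comm _ κ′ ⟩
      κ′ + μ * a i     ∎)

  affine-closed : ∀ {f g h} → IsAffine f → IsAffine g → IsAffine h →
                  ∃ λ φ → IsAffine φ × (∀ x k → h x ≡ g k → φ x ≡ f k)
  affine-closed {f} {g} {h} (μf , κf , μf≉0 , f-eq) g-affine@(μg , κg , μg≉0 , g-eq) (μh , κh , μh≉0 , h-eq) =
    φ , (μF , κF , μF≉0 , F-eq) , λ x k hx≡gk → ≡.cong f (affine-injective g-affine (≡.trans (g∘g⁻¹ (h x)) hx≡gk))
    where
    g⁻¹ = λ y → proj₁ (injective⇒surjective g (affine-injective g-affine) y)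
    g∘g⁻¹ = λ y → proj₂ (injective⇒surjective g (affine-injective g-affine) y)
    φ = λ x → f (g⁻¹ (h x))
    μg⁻¹ = inv μg μg≉0
    μF = μf * μh * μg⁻¹
    κF = μf * (κh - κg) * μg⁻¹ + κf
    μF≉0 : ¬ μF ≈ 0#
    μF≉0 = *-nonzero (*-nonzero μf≉0 μh≉0) (inv-nonzero μg μg≉0)
    F-eq : ∀ x → μF * a x + κF ≈ b (φ x)
    F-eq x = begin
      μF * a x + κF
        ≈⟨ solve 7 (λ μf μh μg⁻¹ ax κh κg κf →
             μf ⊗ μh ⊗ μg⁻¹ ⊗ ax ⊕ (μf ⊗ (κh ⊕ ⊝ κg) ⊗ μg⁻¹ ⊕ κf)
               ⊜ μf ⊗ (μg⁻¹ ⊗ ((μh ⊗ ax ⊕ κh) ⊕ ⊝ κg)) ⊕ κf) refl μf μh μg⁻¹ (a x) κh κg κf ⟩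
      μf * (μg⁻¹ * ((μh * a x + κh) - κg)) + κf
        ≈⟨ +-congʳ (*-congˡ (*-congˡ (+-congʳ gₖ≈hₓ))) ⟨
      μf * (μg⁻¹ * ((μg * a k + κg) - κg)) + κf
        ≈⟨ +-congʳ (*-congˡ (solve 4 (λ i μ x κ → i ⊗ ((μ ⊗ x ⊕ κ) ⊕ ⊝ κ) ⊜ (i ⊗ μ) ⊗ x)
                                 refl μg⁻¹ μg (a k) κg)) ⟩
      μf * ((μg⁻¹ * μg) * a k) + κf
        ≈⟨ +-congʳ (*-congˡ (trans (*-congʳ (*-inverseˡ μg μg≉0)) (*-identityˡ (a k)))) ⟩
      μf * a k + κf
        ≈⟨ f-eq k ⟩
      b (f k) ∎
      where
      k = g⁻¹ (h x)
      gₖ≈hₓ : μg * a k + κg ≈ μh * a x + κh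
      gₖ≈hₓ = trans (g-eq k) (trans (reflexive (≡.cong b (g∘g⁻¹ (h x)))) (sym (h-eq x)))

module AntipodalPlaneGeometry {s′ : ℕ} (A : AntipodalPlane (suc s′)) where

  open import Data.Nat as ℕ using (s≤s)
  import Data.Nat.Properties as ℕ
  open import Data.Nat.Tactic.RingSolver using (solve-∀)
  open import Data.Fin using (combine)
  open import Data.Fin.Properties using (_≟_; any?; injective⇒≤)
  open import Data.Fin.Subset using (Subset; _∈_; ∣_∣; _-_)
  open import Data.Fin.Subset.Properties using (_∈?_; x∈p∧x≢y⇒x∈p-y)
  open import Data.Vec using (tabulate; lookup)
  open import Data.Vec.Properties using (lookup⇒[]=; []=⇒lookup; lookup∘tabulate)
  open import Data.Product using (∃; _×_; _,_; proj₁; proj₂)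
  open import Relation.Nullary using (Dec; yes; no; ¬?)
  open import Relation.Nullary.Decidable using (_×-dec_; decidable-stable)
  open import Relation.Nullary.Negation using (contradiction)
  open import Relation.Binary.PropositionalEquality

  open AntipodalPlane A
  open FiniteSets

  s : ℕ
  s = suc s′

  N : ℕ
  N = np s

  infix 4 _on_
  _on_ : Fin N → Fin N → Set
  p on l = p ∈ line l

  on? : ∀ p l → Dec (p on l)
  on? p l = p ∈? line l

  lines-through : Fin N → Subset N
  lines-through p = tabulate (λ l → lookup (line l) p)

  on⇒∈lines-through : ∀ {p l} → p on l → l ∈ lines-through p
  on⇒∈lines-through {p} {l} p∈l =
    lookup⇒[]= l (lines-through p) (trans (lookup∘tabulate (λ l → lookup (line l) p) l) ([]=⇒lookup p∈l))

  ∈lines-through⇒on : ∀ {p l} → l ∈ lines-through p → p on l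
  ∈lines-through⇒on {p} {l} l∈ =
    lookup⇒[]= p (line l) (trans (sym (lookup∘tabulate (λ l → lookup (line l) p) l)) ([]=⇒lookup l∈))

  ∣line∣ : ∀ l → ∣ line l ∣ ≡ suc s
  ∣line∣ l = trans (lineSize l) (ℕ.+-comm s 1)

  ∣lines-through∣ : ∀ p → ∣ lines-through p ∣ ≡ suc s
  ∣lines-through∣ p = trans (pointDegree p) (ℕ.+-comm s 1)

  ∣line-p∣ : ∀ {p l} → p on l → ∣ line l - p ∣ ≡ s
  ∣line-p∣ {p} {l} p∈l = ℕ.suc-injective (trans (suc∣p-x∣≡∣p∣ (line l) p∈l) (∣line∣ l))

  ∣lines-through-l∣ : ∀ {p l} → p on l → ∣ lines-through p - l ∣ ≡ s
  ∣lines-through-l∣ {p} {l} p∈l =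
    ℕ.suc-injective (trans (suc∣p-x∣≡∣p∣ (lines-through p) (on⇒∈lines-through p∈l)) (∣lines-through∣ p))

  unique-line : ∀ {p p′ l l′} → p ≢ p′ → p on l → p′ on l → p on l′ → p′ on l′ → l ≡ l′
  unique-line p≢p′ = partialLinear _ _ p≢p′ _ _

  Disjoint : Fin N → Fin N → Set
  Disjoint l m = ∀ p → p on l → ¬ p on m

  Meet : Fin N → Fin N → Set
  Meet l m = ∃ λ p → p on l × p on m

  meet? : ∀ l m → Dec (Meet l m)
  meet? l m = any? (λ p → on? p l ×-dec on? p m)

  ¬Meet⇒Disjoint : ∀ {l m} → ¬ Meet l m → Disjoint l m
  ¬Meet⇒Disjoint ∄p p p∈l p∈m = ∄p (p , p∈l , p∈m)

  Disjoint-sym : ∀ {l m} → Disjoint l m → Disjoint m l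
  Disjoint-sym l∥m p p∈m p∈l = l∥m p p∈l p∈m

  Collinear : Fin N → Fin N → Set
  Collinear p p′ = ∃ λ l → p on l × p′ on l

  collinear? : ∀ p p′ → Dec (Collinear p p′)
  collinear? p p′ = any? (λ l → on? p l ×-dec on? p′ l)

  Collinear-sym : ∀ {p p′} → Collinear p p′ → Collinear p′ p
  Collinear-sym (l , p∈l , p′∈l) = l , p′∈l , p∈l

  points : ∀ l → Enumeration (suc s) (line l)
  points l = enumeration (line l) (∣line∣ l)

  other-lines : ∀ {p l} → p on l → Enumeration s (lines-through p - l)
  other-lines p∈l = enumeration _ (∣lines-through-l∣ p∈l)

  module Pencil (K : Fin N) where

    point : Fin (suc s) → Fin N
    point = Enumeration.at (points K)

    point-on : ∀ i → point i on K
    point-on = Enumeration.at-∈ (points K)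

    other-lines-at : ∀ i → Enumeration s (lines-through (point i) - K)
    other-lines-at i = other-lines (point-on i)

    line-at : Fin (suc s) → Fin s → Fin N
    line-at i = Enumeration.at (other-lines-at i)

    point-on-line-at : ∀ i j → point i on line-at i j
    point-on-line-at i j = ∈lines-through⇒on (x∈p-y⇒x∈p _ (Enumeration.at-∈ (other-lines-at i) j))

    line-at≢K : ∀ i j → line-at i j ≢ K
    line-at≢K i j = x∈p-y⇒x≢y _ (Enumeration.at-∈ (other-lines-at i) j)

    line-at-injective : ∀ {i j i′ j′} → line-at i j ≡ line-at i′ j′ → i ≡ i′ × j ≡ j′
    line-at-injective {i} {j} {i′} {j′} e with i ≟ i′
    ... | yes refl = refl , Enumeration.at-injective (other-lines-at i) e
    ... | no i≢i′ = contradiction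
          (unique-line (λ pᵢ≡pᵢ′ → i≢i′ (Enumeration.at-injective (points K) pᵢ≡pᵢ′))
            (point-on-line-at i j) (subst (point i′ on_) (sym e) (point-on-line-at i′ j′))
            (point-on i) (point-on i′))
          (line-at≢K i j)

    line-at-covers : ∀ {l} → Meet K l → l ≢ K → ∃ λ i → ∃ λ j → line-at i j ≡ l
    line-at-covers {l} (p , p∈K , p∈l) l≢K =
      let i , pᵢ≡p = Enumeration.at-surjective (points K) p∈K
          j , e = Enumeration.at-surjective (other-lines-at i)
                    (x∈p∧x≢y⇒x∈p-y (on⇒∈lines-through (subst (_on l) (sym pᵢ≡p) p∈l)) l≢K)
      in i , j , e

  disjoint-unique : ∀ {K K′ K₀} → Disjoint K K₀ → Disjoint K′ K₀ → K ≡ K′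
  disjoint-unique {K} {K′} {K₀} K∥K₀ K′∥K₀ with K ≟ K′
  ... | yes K≡K′ = K≡K′
  ... | no  K≢K′ = contradiction (injective⇒≤ {f = g} g-injective) (ℕ.<⇒≱ (ℕ.≤-reflexive (count s)))
    where
    open Pencil K₀
    count : ∀ s → suc (s ℕ.* s ℕ.+ s ℕ.+ 2) ≡ 3 ℕ.+ suc s ℕ.* s
    count = solve-∀
    ≢K₀ : ∀ {L} → Disjoint L K₀ → L ≢ K₀
    ≢K₀ {L} L∥K₀ refl = L∥K₀ p (Enumeration.at-∈ (points L) zero) (Enumeration.at-∈ (points L) zero)
      where p = Enumeration.at (points L) zero
    ≢line-at : ∀ {L} → Disjoint L K₀ → ∀ i j → L ≢ line-at i j
    ≢line-at L∥K₀ i j refl = L∥K₀ (point i) (point-on-line-at i j) (point-on i)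
    g : Fin (3 ℕ.+ suc s ℕ.* s) → Fin N
    g zero                = K₀
    g (suc zero)          = K
    g (suc (suc zero))    = K′
    g (suc (suc (suc k))) = uncurryFin line-at k
    g-injective : Injective _≡_ _≡_ g
    g-injective {zero}                {zero}                _ = refl
    g-injective {zero}                {suc zero}            e = contradiction (sym e) (≢K₀ K∥K₀)
    g-injective {zero}                {suc (suc zero)}      e = contradiction (sym e) (≢K₀ K′∥K₀)
    g-injective {zero}                {suc (suc (suc k))}   e = contradiction (sym e) (line-at≢K _ _)
    g-injective {suc zero}            {zero}                e = contradiction e (≢K₀ K∥K₀)
    g-injective {suc zero}            {suc zero}            _ = refl
    g-injective {suc zero}            {suc (suc zero)}      e = contradiction e K≢K′
    g-injective {suc zero}            {suc (suc (suc k))}   e = contradiction e (≢line-at K∥K₀ _ _)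
    g-injective {suc (suc zero)}      {zero}                e = contradiction e (≢K₀ K′∥K₀)
    g-injective {suc (suc zero)}      {suc zero}            e = contradiction (sym e) K≢K′
    g-injective {suc (suc zero)}      {suc (suc zero)}      _ = refl
    g-injective {suc (suc zero)}      {suc (suc (suc k))}   e = contradiction e (≢line-at K′∥K₀ _ _)
    g-injective {suc (suc (suc k))}   {zero}                e = contradiction e (line-at≢K _ _)
    g-injective {suc (suc (suc k))}   {suc zero}            e = contradiction (sym e) (≢line-at K∥K₀ _ _)
    g-injective {suc (suc (suc k))}   {suc (suc zero)}      e = contradiction (sym e) (≢line-at K′∥K₀ _ _)
    g-injective {suc (suc (suc k))}   {suc (suc (suc k′))}  e =
      cong (λ k → suc (suc (suc k))) (uncurryFin-injective line-at line-at-injective e)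

  ∃-disjoint : ∀ L → ∃ λ L′ → Disjoint L L′
  ∃-disjoint L = L′ , ¬Meet⇒Disjoint (λ meet → L′∉ (P⇒∈satisfying (meet? L) meet))
    where
    open Pencil L
    count : ∀ s → suc (suc (suc s ℕ.* s)) ≡ s ℕ.* s ℕ.+ s ℕ.+ 2
    count = solve-∀
    f : Fin (suc (suc s ℕ.* s)) → Fin N
    f zero    = L
    f (suc k) = uncurryFin line-at k
    f-covers : ∀ {l} → l ∈ satisfying (meet? L) → ∃ λ k → f k ≡ l
    f-covers {l} l∈ with l ≟ L
    ... | yes refl = zero , refl
    ... | no l≢L = let i , j , e = line-at-covers (∈satisfying⇒P (meet? L) l∈) l≢L in
                   suc (combine i j) , trans (uncurryFin-combine line-at i j) e
    missed = ∣p∣<n⇒∃∉ (satisfying (meet? L)) (ℕ.≤-trans (s≤s (covering⇒≥ _ f f-covers)) (ℕ.≤-reflexive (count s)))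
    L′ = proj₁ missed
    L′∉ = proj₂ missed

  module Antipodes {K K′ : Fin N} (K∥K′ : Disjoint K K′) where

    meets-K′ : ∀ {M} → M ≢ K → Meet M K′
    meets-K′ {M} M≢K with meet? M K′
    ... | yes meet = meet
    ... | no ¬meet = contradiction (disjoint-unique (¬Meet⇒Disjoint ¬meet) K∥K′) M≢K

    ∃-antipode : ∀ {x} → x on K → ∃ λ y → y on K′ × ¬ Collinear x y
    ∃-antipode {x} x∈K with any? (λ y → on? y K′ ×-dec ¬? (collinear? x y))
    ... | yes found = found
    ... | no ∄found = contradiction
            (injective-into⇒≤ (lines-through x - K) g g∈ g-injective)
            (ℕ.<⇒≱ (ℕ.≤-reflexive (cong suc (∣lines-through-l∣ x∈K))))
      where
      y = Enumeration.at (points K′)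
      y∈K′ = Enumeration.at-∈ (points K′)
      joining : ∀ i → Collinear x (y i)
      joining i = decidable-stable (collinear? x (y i)) (λ ¬c → ∄found (y i , y∈K′ i , ¬c))
      g : Fin (suc s) → Fin N
      g i = proj₁ (joining i)
      x∈g = λ i → proj₁ (proj₂ (joining i))
      y∈g = λ i → proj₂ (proj₂ (joining i))
      g∈ : ∀ i → g i ∈ lines-through x - K
      g∈ i = x∈p∧x≢y⇒x∈p-y (on⇒∈lines-through (x∈g i))
               (λ gᵢ≡K → K∥K′ (y i) (subst (y i on_) gᵢ≡K (y∈g i)) (y∈K′ i))
      g-injective : Injective _≡_ _≡_ g
      g-injective {i} {i′} e with i ≟ i′
      ... | yes i≡i′ = i≡i′
      ... | no  i≢i′ = contradiction
              (subst (x on_) (unique-line (λ e′ → i≢i′ (Enumeration.at-injective (points K′) e′))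
                 (y∈g i) (subst (y i′ on_) (sym e) (y∈g i′)) (y∈K′ i) (y∈K′ i′)) (x∈g i))
              (K∥K′ x x∈K)

    antipode-unique : ∀ {x y y′} → x on K → y on K′ → y′ on K′ →
                      ¬ Collinear x y → ¬ Collinear x y′ → y ≡ y′
    antipode-unique {x} {y} {y′} x∈K y∈K′ y′∈K′ x≁y x≁y′ with y ≟ y′
    ... | yes y≡y′ = y≡y′
    ... | no  y≢y′ = contradiction
            (injective-into⇒≤ (line K′ - y - y′) meeting meeting∈ meeting-injective)
            (ℕ.<⇒≱ (ℕ.≤-reflexive (trans (suc∣p-x∣≡∣p∣ _ y′∈K′-y) (∣line-p∣ y∈K′))))
      where
      y′∈K′-y = x∈p∧x≢y⇒x∈p-y y′∈K′ (λ e → y≢y′ (sym e))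
      M = Enumeration.at (other-lines x∈K)
      x∈M : ∀ j → x on M j
      x∈M j = ∈lines-through⇒on (x∈p-y⇒x∈p _ (Enumeration.at-∈ (other-lines x∈K) j))
      M-meets : ∀ j → Meet (M j) K′
      M-meets j = meets-K′ (x∈p-y⇒x≢y _ (Enumeration.at-∈ (other-lines x∈K) j))
      meeting : Fin s → Fin N
      meeting j = proj₁ (M-meets j)
      meeting∈M = λ j → proj₁ (proj₂ (M-meets j))
      meeting∈K′ = λ j → proj₂ (proj₂ (M-meets j))
      meeting∈ : ∀ j → meeting j ∈ line K′ - y - y′
      meeting∈ j = x∈p∧x≢y⇒x∈p-y
        (x∈p∧x≢y⇒x∈p-y (meeting∈K′ j) (λ e → x≁y (M j , x∈M j , subst (_on M j) e (meeting∈M j))))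
        (λ e → x≁y′ (M j , x∈M j , subst (_on M j) e (meeting∈M j)))
      meeting-injective : Injective _≡_ _≡_ meeting
      meeting-injective {j} {j′} e = Enumeration.at-injective (other-lines x∈K)
        (unique-line (λ e′ → K∥K′ x x∈K (subst (_on K′) e′ (meeting∈K′ j)))
          (meeting∈M j) (x∈M j) (subst (_on M j′) (sym e) (meeting∈M j′)) (x∈M j′))

    collinear-unless-antipode : ∀ {x y} → x on K → y on K′ → ¬ Collinear x y →
                                ∀ {y′} → y′ on K′ → y′ ≢ y → Collinear x y′
    collinear-unless-antipode x∈K y∈K′ x≁y y′∈K′ y′≢y = decidable-stable (collinear? _ _)
      (λ x≁y′ → y′≢y (sym (antipode-unique x∈K y∈K′ y′∈K′ x≁y x≁y′)))

  module Perspectivities {L L′ : Fin N} (L∥L′ : Disjoint L L′) where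

    private
      module L→L′ = Antipodes L∥L′
      module L′→L = Antipodes (Disjoint-sym L∥L′)

    X : Fin (suc s) → Fin N
    X = Enumeration.at (points L)

    X-on : ∀ i → X i on L
    X-on = Enumeration.at-∈ (points L)

    X-injective : Injective _≡_ _≡_ X
    X-injective = Enumeration.at-injective (points L)

    Y : Fin (suc s) → Fin N
    Y = Enumeration.at (points L′)

    Y-on : ∀ j → Y j on L′
    Y-on = Enumeration.at-∈ (points L′)

    Y-injective : Injective _≡_ _≡_ Y
    Y-injective = Enumeration.at-injective (points L′)

    X≢Y : ∀ i j → X i ≢ Y j
    X≢Y i j e = L∥L′ (X i) (X-on i) (subst (_on L′) (sym e) (Y-on j))

    opaque
      antipode : ∀ i → ∃ λ j → ¬ Collinear (X i) (Y j)
      antipode i = let y , y∈L′ , x≁y = L→L′.∃-antipode (X-on i)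
                       j , Yj≡y = Enumeration.at-surjective (points L′) y∈L′
                   in j , subst (λ y → ¬ Collinear (X i) y) (sym Yj≡y) x≁y

    σ : Fin (suc s) → Fin (suc s)
    σ i = proj₁ (antipode i)

    X≁Yσ : ∀ i → ¬ Collinear (X i) (Y (σ i))
    X≁Yσ i = proj₂ (antipode i)

    X∼Y : ∀ {i j} → j ≢ σ i → Collinear (X i) (Y j)
    X∼Y {i} j≢σi = L→L′.collinear-unless-antipode (X-on i) (Y-on (σ i)) (X≁Yσ i) (Y-on _)
                     (λ e → j≢σi (Y-injective e))

    σ-injective : Injective _≡_ _≡_ σ
    σ-injective {i} {i′} σi≡σi′ = X-injective
      (L′→L.antipode-unique (Y-on (σ i)) (X-on i) (X-on i′)
        (λ c → X≁Yσ i (Collinear-sym c))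
        (λ c → X≁Yσ i′ (subst (λ k → Collinear (X i′) (Y k)) σi≡σi′ (Collinear-sym c))))

    Off : Fin N → Set
    Off q = ¬ q on L × ¬ q on L′

    off? : ∀ q → Dec (Off q)
    off? q = ¬? (on? q L) ×-dec ¬? (on? q L′)

    Joins : Fin N → Fin (suc s) → Fin (suc s) → Set
    Joins q i j = ∃ λ l → q on l × X i on l × Y j on l

    joins? : ∀ q i j → Dec (Joins q i j)
    joins? q i j = any? (λ l → on? q l ×-dec (on? (X i) l ×-dec on? (Y j) l))

    module _ {q : Fin N} (off : Off q) where

      private
        q∉L = proj₁ off
        q∉L′ = proj₂ off
        lines-at-q = enumeration (lines-through q) (∣lines-through∣ q)
        M = Enumeration.at lines-at-q
        q∈M : ∀ k → q on M k
        q∈M k = ∈lines-through⇒on (Enumeration.at-∈ lines-at-q k)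
        M-meets-L : ∀ k → Meet (M k) L
        M-meets-L k = L′→L.meets-K′ (λ Mₖ≡L′ → q∉L′ (subst (q on_) Mₖ≡L′ (q∈M k)))
        meeting : Fin (suc s) → Fin N
        meeting k = proj₁ (M-meets-L k)
        meeting∈M = λ k → proj₁ (proj₂ (M-meets-L k))
        meeting∈L = λ k → proj₂ (proj₂ (M-meets-L k))
        meeting-injective : Injective _≡_ _≡_ meeting
        meeting-injective {k} {k′} e = Enumeration.at-injective lines-at-q
          (unique-line (λ e′ → q∉L (subst (_on L) e′ (meeting∈L k)))
            (meeting∈M k) (q∈M k) (subst (_on M k′) (sym e) (meeting∈M k′)) (q∈M k′))

      collinear-with-X : ∀ i → Collinear q (X i)
      collinear-with-X i with any? (λ k → meeting k ≟ X i)
      ... | yes (k , e) = M k , q∈M k , subst (_on M k) e (meeting∈M k)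
      ... | no ∄k = contradiction
              (injective-into⇒≤ (line L - X i) meeting
                (λ k → x∈p∧x≢y⇒x∈p-y (meeting∈L k) (λ e → ∄k (k , e))) meeting-injective)
              (ℕ.<⇒≱ (ℕ.≤-reflexive (cong suc (∣line-p∣ (X-on i)))))

      joins-some : ∀ i → ∃ (Joins q i)
      joins-some i =
        let l , q∈l , Xᵢ∈l = collinear-with-X i
            y , y∈l , y∈L′ = L→L′.meets-K′ {l} (λ l≡L → q∉L (subst (q on_) l≡L q∈l))
            j , Yⱼ≡y = Enumeration.at-surjective (points L′) y∈L′
        in j , l , q∈l , Xᵢ∈l , subst (_on l) (sym Yⱼ≡y) y∈l

    -- For q on L or L′, τ q is a junk value.
    opaque
      τ : Fin N → Fin (suc s) → Fin (suc s)
      τ q i with any? (joins? q i)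
      ... | yes (j , _) = j
      ... | no _        = zero

      τ-joins : ∀ {q} → Off q → ∀ i → Joins q i (τ q i)
      τ-joins {q} off i with any? (joins? q i)
      ... | yes (_ , joins) = joins
      ... | no ∄j = contradiction (joins-some off i) ∄j

    join : ∀ {q} → Off q → Fin (suc s) → Fin N
    join off i = proj₁ (τ-joins off i)

    q∈join : ∀ {q} (off : Off q) i → q on join off i
    q∈join off i = proj₁ (proj₂ (τ-joins off i))

    X∈join : ∀ {q} (off : Off q) i → X i on join off i
    X∈join off i = proj₁ (proj₂ (proj₂ (τ-joins off i)))

    Y∈join : ∀ {q} (off : Off q) i → Y (τ q i) on join off i
    Y∈join off i = proj₂ (proj₂ (proj₂ (τ-joins off i)))

    τ-avoids-σ : ∀ {q} → Off q → ∀ i → τ q i ≢ σ i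
    τ-avoids-σ off i τqi≡σi =
      X≁Yσ i (join off i , X∈join off i , subst (λ j → Y j on join off i) τqi≡σi (Y∈join off i))

    τ-injective : ∀ {q} → Off q → Injective _≡_ _≡_ (τ q)
    τ-injective {q} off@(q∉L , q∉L′) {i} {i′} τqi≡τqi′ with i ≟ i′
    ... | yes i≡i′ = i≡i′
    ... | no  i≢i′ = contradiction (subst (q on_) l≡L (q∈join off i)) q∉L
      where
      l≡l′ : join off i ≡ join off i′
      l≡l′ = unique-line (λ e → q∉L′ (subst (_on L′) (sym e) (Y-on _)))
               (q∈join off i) (Y∈join off i) (q∈join off i′)
               (subst (λ j → Y j on join off i′) (sym τqi≡τqi′) (Y∈join off i′))
      l≡L : join off i ≡ L
      l≡L = unique-line (λ e → i≢i′ (X-injective e))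
              (X∈join off i) (subst (X i′ on_) (sym l≡l′) (X∈join off i′)) (X-on i) (X-on i′)

    τ-determines-centre : ∀ {q q′} → Off q → Off q′ → (∀ i → τ q i ≡ τ q′ i) → q ≡ q′
    τ-determines-centre {q} {q′} off@(q∉L , _) off′ τq≗τq′ with q ≟ q′
    ... | yes q≡q′ = q≡q′
    ... | no  q≢q′ = contradiction
            (unique-line q≢q′ (q∈join off zero) (q′∈join zero) (q∈join off (suc zero)) (q′∈join (suc zero)))
            l₀≢l₁
      where
      q′∈join : ∀ i → q′ on join off i
      q′∈join i = subst (q′ on_)
        (unique-line (X≢Y i (τ q i))
          (X∈join off′ i) (subst (λ j → Y j on join off′ i) (sym (τq≗τq′ i)) (Y∈join off′ i))
          (X∈join off i) (Y∈join off i))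
        (q∈join off′ i)
      0≢1 : zero ≢ suc zero
      0≢1 ()
      l₀≢l₁ : join off zero ≢ join off (suc zero)
      l₀≢l₁ e = q∉L (subst (q on_)
        (unique-line (λ e′ → 0≢1 (X-injective e′))
          (X∈join off zero) (subst (X (suc zero) on_) (sym e) (X∈join off (suc zero))) (X-on zero) (X-on (suc zero)))
        (q∈join off zero))

    centres : ∀ i j → j ≢ σ i →
              ∃ λ (q : Fin s′ → Fin N) → Injective _≡_ _≡_ q × (∀ a → Off (q a)) × (∀ a → τ (q a) i ≡ j)
    centres i j j≢σi = q , Enumeration.at-injective on-M , q-off , τq≡j
      where
      M = proj₁ (X∼Y j≢σi)
      Xᵢ∈M = proj₁ (proj₂ (X∼Y j≢σi))
      Yⱼ∈M = proj₂ (proj₂ (X∼Y j≢σi))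
      Yⱼ∈M-Xᵢ = x∈p∧x≢y⇒x∈p-y Yⱼ∈M (λ e → X≢Y i j (sym e))
      on-M = enumeration (line M - X i - Y j)
               (ℕ.suc-injective (trans (suc∣p-x∣≡∣p∣ _ Yⱼ∈M-Xᵢ) (∣line-p∣ Xᵢ∈M)))
      q = Enumeration.at on-M
      q∈M-Xᵢ = λ a → x∈p-y⇒x∈p _ (Enumeration.at-∈ on-M a)
      q∈M = λ a → x∈p-y⇒x∈p _ (q∈M-Xᵢ a)
      q≢Xᵢ = λ a → x∈p-y⇒x≢y _ (q∈M-Xᵢ a)
      q≢Yⱼ = λ a → x∈p-y⇒x≢y _ (Enumeration.at-∈ on-M a)
      q-off : ∀ a → Off (q a)
      q-off a =
        (λ q∈L → L∥L′ (Y j) (subst (Y j on_) (unique-line (q≢Xᵢ a) (q∈M a) Xᵢ∈M q∈L (X-on i)) Yⱼ∈M) (Y-on j)) ,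
        (λ q∈L′ → L∥L′ (X i) (X-on i) (subst (X i on_) (unique-line (q≢Yⱼ a) (q∈M a) Yⱼ∈M q∈L′ (Y-on j)) Xᵢ∈M))
      τq≡j : ∀ a → τ (q a) i ≡ j
      τq≡j a = decidable-stable (τ (q a) i ≟ j) λ τ≢j →
        let l≡M = unique-line (q≢Xᵢ a) (q∈join (q-off a) i) (X∈join (q-off a) i) (q∈M a) Xᵢ∈M
            M≡L′ = unique-line (λ e → τ≢j (Y-injective e)) (subst (Y (τ (q a) i) on_) l≡M (Y∈join (q-off a) i))
                     Yⱼ∈M (Y-on _) (Y-on j)
        in L∥L′ (X i) (X-on i) (subst (X i on_) M≡L′ Xᵢ∈M)

module EmbeddedAntipodalPlane {c ℓ} (F : FiniteField c ℓ) (k : ℕ) (A : AntipodalPlane (4 Nat.+ k))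
  (embedding : PG2.Embedding F A) where

  open import Data.Product using (∃; _,_; proj₁; proj₂)
  open import Data.Empty using (⊥)
  open import Relation.Nullary using (Dec; yes; no)
  open import Relation.Nullary.Negation using (¬¬-map; contradiction)
  open import Relation.Binary.PropositionalEquality using (_≢_)

  open FiniteField F hiding (zero)
  open PG2.Embedding embedding
  open Vec3Identities commRing using (Vec3; dot; det)
  open PlaneGeometry F
  open AntipodalPlaneGeometry A
  open import Relation.Binary.Reasoning.Setoid setoid

  module _ {L L′ : Fin N} (L∥L′ : Disjoint L L′) where

    open Perspectivities L∥L′

    X-on-L : ∀ i → dot (ψ L) (φ (X i)) ≈ 0#
    X-on-L i = incidence (X i) L (X-on i)

    X-off-L′ : ∀ i → ¬ dot (ψ L′) (φ (X i)) ≈ 0#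
    X-off-L′ i = nonincidence (X i) L′ (L∥L′ (X i) (X-on i))

    Y-on-L′ : ∀ j → dot (ψ L′) (φ (Y j)) ≈ 0#
    Y-on-L′ j = incidence (Y j) L′ (Y-on j)

    Y-off-L : ∀ j → ¬ dot (ψ L) (φ (Y j)) ≈ 0#
    Y-off-L j = nonincidence (Y j) L (λ Yⱼ∈L → L∥L′ (Y j) Yⱼ∈L (Y-on j))

    module _ (e : Vec3) (D≉0 : ¬ det (ψ L) (ψ L′) e ≈ 0#) where

      a : Fin (5 Nat.+ k) → Carrier
      a i = coordinate (ψ L′) e (φ (X i)) (X-off-L′ i)

      b : Fin (5 Nat.+ k) → Carrier
      b j = coordinate (ψ L) e (φ (Y j)) (Y-off-L j)

      a-injective : Injective _≡_ _≈_ a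
      a-injective {i} {i′} aᵢ≈aᵢ′ = X-injective (φ-injective (X i) (X i′)
        (coordinate-injective (ψ L) (ψ L′) e (φ (X i)) (φ (X i′)) D≉0
          (X-on-L i) (X-on-L i′) (X-off-L′ i) (X-off-L′ i′) aᵢ≈aᵢ′))

      b-injective : Injective _≡_ _≈_ b
      b-injective {j} {j′} bⱼ≈bⱼ′ = Y-injective (φ-injective (Y j) (Y j′)
        (coordinate-injective (ψ L′) (ψ L) e (φ (Y j)) (φ (Y j′)) (det-swap-nonzero (ψ L) (ψ L′) e D≉0)
          (Y-on-L′ j) (Y-on-L′ j′) (Y-off-L j) (Y-off-L j′) bⱼ≈bⱼ′))

      open AffineMaps F a b a-injective b-injective

      -- Equality in F is not decidable, so collinearity only yields ¬ ¬ (det ≈ 0#) and the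
      -- argument runs under double negation.
      τ-affine : ∀ {p} → Off p → ¬ ¬ IsAffine (τ p)
      τ-affine {p} off@(p∉L , _) = ¬¬-map affine (¬¬-∀-Fin collinear)
        where
        perspectivity = perspectivity-affine (ψ L) (ψ L′) e (φ p) D≉0 (nonincidence p L p∉L)
        μ = proj₁ perspectivity
        κ = proj₁ (proj₂ perspectivity)
        collinear : ∀ i → ¬ ¬ det (φ (X i)) (φ p) (φ (Y (τ p i))) ≈ 0#
        collinear i = concurrent⇒det≈0 (φ (X i)) (φ p) (φ (Y (τ p i))) (ψ (join off i)) (ψ-nonzero (join off i))
          (incidence _ _ (X∈join off i)) (incidence _ _ (q∈join off i)) (incidence _ _ (Y∈join off i))
        affine : (∀ i → det (φ (X i)) (φ p) (φ (Y (τ p i))) ≈ 0#) → IsAffine (τ p)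
        affine dets = μ , κ , μ≉0 , λ i → sym (b≈μa+κ i)
          where
          b≈μa+κ : ∀ i → b (τ p i) ≈ μ * a i + κ
          b≈μa+κ i = proj₂ (proj₂ perspectivity) (φ (X i)) (φ (Y (τ p i)))
            (X-on-L i) (X-off-L′ i) (Y-on-L′ (τ p i)) (Y-off-L (τ p i)) (dets i)
          μ≉0 : ¬ μ ≈ 0#
          μ≉0 μ≈0 = contradiction (τ-injective off (b-injective (begin
            b (τ p zero)             ≈⟨ b≈μa+κ zero ⟩
            μ * a zero + κ           ≈⟨ +-congʳ (trans (*-congʳ μ≈0) (zeroˡ _)) ⟩
            0# + κ                   ≈⟨ +-congʳ (trans (*-congʳ μ≈0) (zeroˡ _)) ⟨
            μ * a (suc zero) + κ     ≈⟨ b≈μa+κ (suc zero) ⟨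
            b (τ p (suc zero))       ∎))) λ ()

      all-τ-affine : ¬ ¬ (∀ p → Off p → IsAffine (τ p))
      all-τ-affine = ¬¬-∀-Fin λ p → off-affine p (off? p)
        where
        off-affine : ∀ p → Dec (Off p) → ¬ ¬ (Off p → IsAffine (τ p))
        off-affine p (yes off) = ¬¬-map (λ affine _ → affine) (τ-affine off)
        off-affine p (no ¬off) ¬affine = ¬affine (λ off → contradiction off ¬off)

      not-all-τ-affine : ¬ (∀ p → Off p → IsAffine (τ p))
      not-all-τ-affine all-affine = AvoidingCover.no-avoiding-cover k IsAffine
        σ σ-injective affine-injective affine-rigid affine-closed family
        where
        open AvoidingCover k IsAffine using (Family; Avoids)
        family : ∀ i j → j ≢ σ i → Σ (Family (3 Nat.+ k) i j) λ Φ → ∀ a → Avoids σ (Family.map Φ a)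
        family i j j≢σi =
          let p , p-injective , p-off , τp≡j = centres i j j≢σi in
          record
            { map = λ a → τ (p a) ; map-∈ = λ a → all-affine (p a) (p-off a) ; map-x = τp≡j
            ; map-distinct = λ a≢a′ τ≗τ → a≢a′ (p-injective (τ-determines-centre (p-off _) (p-off _) τ≗τ)) }
          , λ a → τ-avoids-σ (p-off a)

    no-transversal : ¬ ∃ λ e → ¬ det (ψ L) (ψ L′) e ≈ 0#
    no-transversal (e , D≉0) = all-τ-affine e D≉0 (not-all-τ-affine e D≉0)

    ⊥-from-disjoint : ⊥
    ⊥-from-disjoint =
      exists-transversal (ψ L) (ψ L′) (φ (X zero)) (ψ-nonzero L) (X-on-L zero) (X-off-L′ zero) no-transversal

  ⊥-from-embedding : ⊥
  ⊥-from-embedding = ⊥-from-disjoint (proj₂ (∃-disjoint zero))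

mainTheorem3 : ∀ {c ℓ} (s : ℕ) → 4 ≤ s → (F : FiniteField c ℓ) →
               ¬ (Σ (AntipodalPlane s) (PG2.Embedding F))
mainTheorem3 (suc (suc (suc (suc k)))) (s≤s (s≤s (s≤s (s≤s z≤n)))) F (A , embedding) =
  EmbeddedAntipodalPlane.⊥-from-embedding F k A embedding
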